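{- Let $\Gamma$ be a finite abelian group and let $x\in\Gamma(3)$. Then $Z_x(\alpha)=\sum_{s\in\langle\!\langle x\rangle\!\rangle}\big(\omega_6\psi_\alpha(s)+\omega_6^5\psi_\alpha(-s)\big)$ is an integer for each $\alpha\in\Gamma$.
   Context: $\Gamma$ is written additively as $\mathbb{Z}_{n_1}\times\cdots\times\mathbb{Z}_{n_k}$, and $x^k$ denotes $kx$. The character is $\psi_\alpha(x)=\prod_j \exp(2\pi i\alpha_jx_j/n_j)$, and $\omega_6=\exp(2\pi i/6)$. $\Gamma(3)$ is the set of elements whose order is divisible by $3$. For $x\in\Gamma(3)$ with $\mathrm{ord}(x)=m$, put $\langle\!\langle x\rangle\!\rangle=\{x^k:1\le k\le m-1,\ \gcd(k,m)=1,\ k\equiv1\pmod3\}$. -}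

module Defs where

open import Data.Nat as ℕ using (ℕ; zero; suc; _<ᵇ_; NonZero; _≤?_; _≤_)
open import Data.Nat.Divisibility using (_∣_; _∣?_)
open import Data.Nat.DivMod using (_mod_; _/_; _%_)
open import Data.Nat.GCD using (gcd)
open import Data.Integer as ℤ using (ℤ; +_)
open import Data.Fin using (Fin; toℕ)
import Data.Fin as Fin
open import Data.List using (List; []; _∷_; _++_; map; replicate; reverse; length; foldr; filter; upTo)
open import Data.Product using (Σ; ∃; _×_; _,_)
open import Data.Bool using (if_then_else_; true; false)
open import Relation.Nullary using (¬_; does)
open import Relation.Nullary.Decidable using (_×-dec_)
open import Relation.Binary.PropositionalEquality using (_≡_)

-- Integer polynomials, as coefficient lists (lowest degree first).
-- Equality of polynomials is taken coefficientwise (via `coeff`),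
-- so trailing zeros are irrelevant.

Poly : Set
Poly = List ℤ

coeff : Poly → ℕ → ℤ
coeff []      _       = + 0
coeff (a ∷ p) zero    = a
coeff (a ∷ p) (suc i) = coeff p i

infixl 6 _+ₚ_ _-ₚ_
infixl 7 _*ₚ_

_+ₚ_ : Poly → Poly → Poly
[]      +ₚ q       = q
(a ∷ p) +ₚ []      = a ∷ p
(a ∷ p) +ₚ (b ∷ q) = (a ℤ.+ b) ∷ (p +ₚ q)

scaleₚ : ℤ → Poly → Poly
scaleₚ c p = map (c ℤ.*_) p

_-ₚ_ : Poly → Poly → Poly
p -ₚ q = p +ₚ scaleₚ (ℤ.- (+ 1)) q

_*ₚ_ : Poly → Poly → Poly
[]      *ₚ q = []
(a ∷ p) *ₚ q = scaleₚ a q +ₚ (+ 0 ∷ (p *ₚ q))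

constₚ : ℤ → Poly
constₚ c = c ∷ []

monoₚ : ℕ → Poly
monoₚ e = replicate e (+ 0) ++ (+ 1 ∷ [])

private
  subPre : List ℤ → List ℤ → List ℤ
  subPre xs       []       = xs
  subPre []       (_ ∷ _)  = []
  subPre (x ∷ xs) (y ∷ ys) = (x ℤ.- y) ∷ subPre xs ys

  -- a and (1 ∷ bt) are written highest degree first; result is the
  -- quotient, highest degree first.
  divH : List ℤ → ℕ → List ℤ → List ℤ
  divH bt zero    a        = []
  divH bt (suc f) []       = []
  divH bt (suc f) (c ∷ a') with length a' <ᵇ length bt
  ... | true  = []
  ... | false = c ∷ divH bt f (subPre a' (map (c ℤ.*_) bt))

  tailL : List ℤ → List ℤ
  tailL []       = []
  tailL (_ ∷ xs) = xs

-- quotient of a by the monic polynomial b (b without trailing zeros)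
divMonic : Poly → Poly → Poly
divMonic a b = reverse (divH (tailL (reverse b)) (length a) (reverse a))

-- Cyclotomic polynomials, via  X^N - 1 = ∏_{d ∣ N} Φ_d.

XN-1 : ℕ → Poly
XN-1 N = monoₚ N -ₚ constₚ (+ 1)

prodDiv : ℕ → List (Σ ℕ (λ _ → Poly)) → Poly
prodDiv N = foldr (λ { (d , φ) acc → if does (d ∣? N) then φ *ₚ acc else acc }) (constₚ (+ 1))

mutual
  cycTable : ℕ → List (Σ ℕ (λ _ → Poly))
  cycTable zero    = []
  cycTable (suc n) = cycTable n ++ ((suc n , Φ (suc n)) ∷ [])

  -- the N-th cyclotomic polynomial (N ≥ 1): the minimal polynomial of
  -- exp(2πi/N); Φ 0 is a meaningless placeholder
  Φ : ℕ → Poly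
  Φ zero    = []
  Φ (suc n) = divMonic (XN-1 (suc n)) (prodDiv (suc n) (cycTable n))

-- For P ∈ ℤ[X], `IsIntegerAt L P` says that P(exp(2πi/L)) is a rational
-- integer: P - c is divisible by Φ_L in ℤ[X] for some c ∈ ℤ (the kernel of
-- evaluation ℤ[X] → ℂ at exp(2πi/L) is exactly Φ_L·ℤ[X]).
IsIntegerAt : ℕ → Poly → Set
IsIntegerAt L P = ∃ λ (c : ℤ) → ∃ λ (Q : Poly) →
  ∀ i → coeff (P -ₚ constₚ c) i ≡ coeff (Φ L *ₚ Q) i

-- Γ = ℤ_{n 0} × ... × ℤ_{n (k-1)}, all n j ≥ 1.

prodFin : ∀ {k} → (Fin k → ℕ) → ℕ
prodFin {zero}  f = 1
prodFin {suc k} f = f Fin.zero ℕ.* prodFin (λ j → f (Fin.suc j))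

sumFin : ∀ {k} → (Fin k → ℕ) → ℕ
sumFin {zero}  f = 0
sumFin {suc k} f = f Fin.zero ℕ.+ sumFin (λ j → f (Fin.suc j))

module Grp (k : ℕ) (n : Fin k → ℕ) (nz : (j : Fin k) → NonZero (n j)) where

  Elt : Set
  Elt = (j : Fin k) → Fin (n j)

  pow : Elt → ℕ → Elt
  pow x a j = ((a ℕ.* toℕ (x j)) mod n j) {{nz j}}

  neg : Elt → Elt
  neg x j = ((n j ℕ.∸ toℕ (x j)) mod n j) {{nz j}}

  IsIdentity : Elt → Set
  IsIdentity x = ∀ j → toℕ (x j) ≡ 0

  IsOrder : Elt → ℕ → Set
  IsOrder x m = 1 ≤ m × IsIdentity (pow x m)
              × (∀ m' → 1 ≤ m' → m' ℕ.< m → ¬ IsIdentity (pow x m'))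

  InΓ3 : Elt → Set
  InΓ3 x = ∃ λ m → IsOrder x m × 3 ∣ m

  -- ⟨⟨x⟩⟩ = { x^a : 1 ≤ a ≤ m-1, gcd(a,m)=1, a ≡ 1 mod 3 }, m = ord x,
  -- listed through its exponents a (distinct a give distinct x^a)
  exps : ℕ → List ℕ
  exps m = filter (λ a → (1 ≤? a) ×-dec ((gcd a m ℕ.≟ 1) ×-dec (a % 3 ℕ.≟ 1))) (upTo m)

  -- all characters take values in the L-th roots of unity, L = 6·∏ n_j;
  -- we write ζ = exp(2πi/L), so ω₆ = ζ^(L/6) and
  -- ψ_α(s) = ∏_j exp(2πi α_j s_j / n_j) = ζ^(Σ_j α_j s_j (L / n_j)).
  L : ℕ
  L = 6 ℕ.* prodFin n

  ψexp : Elt → Elt → ℕ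
  ψexp α s = sumFin (λ j → toℕ (α j) ℕ.* toℕ (s j) ℕ.* (L / n j) {{nz j}})

  -- polynomial P with P(ζ) = ω₆ ψ_α(s) + ω₆^5 ψ_α(-s)
  term : Elt → Elt → Poly
  term α s = monoₚ (L / 6 ℕ.+ ψexp α s) +ₚ monoₚ (5 ℕ.* (L / 6) ℕ.+ ψexp α (neg s))

  -- polynomial whose value at ζ is Z_x(α) (x of order m)
  Zpoly : Elt → ℕ → Elt → Poly
  Zpoly x m α = foldr (λ a acc → term α (pow x a) +ₚ acc) [] (exps m)

  ZIsInteger : Elt → ℕ → Elt → Set
  ZIsInteger x m α = IsIntegerAt L (Zpoly x m α)

{-# OPTIONS --safe #-}

-- Let ζ = exp(2πi/L) with L = 6P as in Defs, ψ_α(x) = ζ^t and s = t + 4P. Since ζ^(3P) = -1 and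
-- ζ^(4P) is a cube root of unity, a ≡ 1 (mod 3) gives ω₆ ψ_α(x^a) = ζ^(P + at) = -ζ^(as), and as
-- 3 ∣ m also ω₆⁵ ψ_α(-x^a) = -ζ^((m-a)s) with m - a ≡ 2 (mod 3). The exponents a of ⟨⟨x⟩⟩ together
-- with their complements m - a are exactly the units modulo m, so Z_x(α) = -Σ_{gcd(a,m)=1} (ζ^s)^a
-- is minus a Ramanujan sum at the m-th root of unity ζ^s. That is an integer: splitting the geometric
-- sum Σ_{a<m} ζ^(as), which is m or 0, by the value of gcd (a, m) expresses it through Ramanujan sums
-- of smaller length.
--
-- Values at ζ are polynomials modulo Φ_L, and Φ_N is defined as the quotient of X^N - 1 by the Φ_d
-- for the proper divisors d of N. By strong induction on N this quotient is exact and monic, and Φ_N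
-- is coprime over ℚ to X^g - 1 for every proper divisor g: with H = ∏_{d∣N,d<N} Φ_d / (X^g - 1),
-- Φ_N·H = 1 + X^g + ⋯ + X^(N-g), which is N/g modulo X^g - 1. This is what permits cancelling a factor
-- X^s - 1 with N ∤ s modulo Φ_N.
module Submission where

open import Defs
open import Level using (0ℓ)
open import Data.Nat as ℕ using (ℕ; zero; suc; _∸_; _%_; _/_; _<ᵇ_; NonZero; s≤s; z≤n)
import Data.Nat.Properties as ℕ
open import Data.Nat.DivMod using (m≡m%n+[m/n]*n; m*[n/m]≡n; m*n/n≡m; m%n<n; %-distribˡ-+; m*n%n≡0; _mod_)
open import Data.Nat.Divisibility as ℕ using (_∣_; _∣?_; divides; ∣⇒≤; ∣-antisym; m∣m*n; n∣m*n)
open import Data.Nat.GCD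
  using (gcd; gcd-GCD; module Bézout; gcd[m,n]∣m; gcd[m,n]∣n; gcd[m,n]≤n; gcd[m,n]≢0; gcd-greatest; gcd-identityˡ;
         c*gcd[m,n]≡gcd[cm,cn])
open import Data.Nat.Induction using (<-rec)
import Data.Nat.Tactic.RingSolver as NatSolver
open import Data.Integer as ℤ using (ℤ; +_)
import Data.Integer.Properties as ℤ
open import Algebra.Properties.CommutativeSemigroup ℤ.+-commutativeSemigroup as ℤ+ using ()
open import Data.Fin as Fin using (Fin; toℕ)
open import Data.Fin.Properties using (toℕ-fromℕ<; toℕ<n)
open import Data.List using (List; []; _∷_; _++_; reverse; length; replicate; foldr; filter; upTo; applyUpTo)
open import Data.List.Properties
  using (reverse-involutive; reverse-++; length-reverse; length-++; length-map; map-++; reverse-map; unfold-reverse)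
open import Data.List.Relation.Unary.All using (All; []; _∷_)
import Data.List.Relation.Unary.All.Properties as All
open import Data.Bool using (true; false; T; if_then_else_)
open import Data.Maybe using (Maybe; just; nothing)
open import Data.Product using (Σ; ∃; ∃₂; _×_; _,_; proj₁; proj₂)
open import Data.Sum using (_⊎_; inj₁; inj₂; [_,_]′)
open import Data.Empty using (⊥-elim)
open import Function using (id; _∘_)
open import Relation.Nullary using (¬_; Dec; yes; no; does)
open import Relation.Nullary.Decidable using (_×-dec_)
open import Relation.Unary using (Pred; Decidable)
open import Relation.Binary.Bundles using (Setoid)
open import Relation.Binary.PropositionalEquality
import Relation.Binary.Reasoning.Setoid as SetoidReasoning
open import Algebra.Bundles using (CommutativeRing)
open import Algebra.Structures using (IsCommutativeRing)
open import Algebra.Definitions.RawMagma using (_∣ʳ_)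
open import Tactic.RingSolver using (solve-∀)
open import Tactic.RingSolver.Core.AlmostCommutativeRing using (AlmostCommutativeRing; fromCommutativeRing)

-- Integer polynomials up to coefficientwise equality

infix 4 _≋_
record _≋_ (p q : Poly) : Set where
  constructor coeffwise
  field coeff-≡ : ∀ i → coeff p i ≡ coeff q i
open _≋_ public

negₚ : Poly → Poly
negₚ = scaleₚ (ℤ.- + 1)

≋-refl : ∀ {p} → p ≋ p
≋-refl .coeff-≡ i = refl

≋-sym : ∀ {p q} → p ≋ q → q ≋ p
≋-sym e .coeff-≡ i = sym (coeff-≡ e i)

≋-trans : ∀ {p q r} → p ≋ q → q ≋ r → p ≋ r
≋-trans e f .coeff-≡ i = trans (coeff-≡ e i) (coeff-≡ f i)

≋-setoid : Setoid 0ℓ 0ℓ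
≋-setoid = record
  { Carrier       = Poly
  ; _≈_           = _≋_
  ; isEquivalence = record { refl = ≋-refl ; sym = ≋-sym ; trans = ≋-trans }
  }

module ≋-Reasoning = SetoidReasoning ≋-setoid

≡⇒≋ : ∀ {p q} → p ≡ q → p ≋ q
≡⇒≋ refl = ≋-refl

coeff-+ₚ : ∀ p q i → coeff (p +ₚ q) i ≡ coeff p i ℤ.+ coeff q i
coeff-+ₚ []      q       i       = sym (ℤ.+-identityˡ _)
coeff-+ₚ (a ∷ p) []      i       = sym (ℤ.+-identityʳ _)
coeff-+ₚ (a ∷ p) (b ∷ q) zero    = refl
coeff-+ₚ (a ∷ p) (b ∷ q) (suc i) = coeff-+ₚ p q i

coeff-scaleₚ : ∀ c p i → coeff (scaleₚ c p) i ≡ c ℤ.* coeff p i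
coeff-scaleₚ c []      i       = sym (ℤ.*-zeroʳ c)
coeff-scaleₚ c (a ∷ p) zero    = refl
coeff-scaleₚ c (a ∷ p) (suc i) = coeff-scaleₚ c p i

coeff-negₚ : ∀ p i → coeff (negₚ p) i ≡ ℤ.- coeff p i
coeff-negₚ p i = trans (coeff-scaleₚ (ℤ.- + 1) p i) (ℤ.-1*i≡-i (coeff p i))

+ₚ-cong : ∀ {p p′ q q′} → p ≋ p′ → q ≋ q′ → p +ₚ q ≋ p′ +ₚ q′
+ₚ-cong {p} {p′} {q} {q′} e f .coeff-≡ i
  rewrite coeff-+ₚ p q i | coeff-+ₚ p′ q′ i = cong₂ ℤ._+_ (coeff-≡ e i) (coeff-≡ f i)

scaleₚ-cong : ∀ c {p q} → p ≋ q → scaleₚ c p ≋ scaleₚ c q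
scaleₚ-cong c {p} {q} e .coeff-≡ i
  rewrite coeff-scaleₚ c p i | coeff-scaleₚ c q i = cong (c ℤ.*_) (coeff-≡ e i)

+ₚ-comm : ∀ p q → p +ₚ q ≋ q +ₚ p
+ₚ-comm p q .coeff-≡ i rewrite coeff-+ₚ p q i | coeff-+ₚ q p i = ℤ.+-comm (coeff p i) (coeff q i)

+ₚ-assoc : ∀ p q r → (p +ₚ q) +ₚ r ≋ p +ₚ (q +ₚ r)
+ₚ-assoc p q r .coeff-≡ i
  rewrite coeff-+ₚ (p +ₚ q) r i | coeff-+ₚ p q i | coeff-+ₚ p (q +ₚ r) i | coeff-+ₚ q r i
  = ℤ.+-assoc (coeff p i) (coeff q i) (coeff r i)

+ₚ-identityˡ : ∀ p → [] +ₚ p ≋ p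
+ₚ-identityˡ p = ≋-refl

+ₚ-identityʳ : ∀ p → p +ₚ [] ≋ p
+ₚ-identityʳ []      = ≋-refl
+ₚ-identityʳ (a ∷ p) = ≋-refl

+ₚ-inverseʳ : ∀ p → p +ₚ negₚ p ≋ []
+ₚ-inverseʳ p .coeff-≡ i rewrite coeff-+ₚ p (negₚ p) i | coeff-negₚ p i = ℤ.+-inverseʳ (coeff p i)

+ₚ-inverseˡ : ∀ p → negₚ p +ₚ p ≋ []
+ₚ-inverseˡ p = ≋-trans (+ₚ-comm (negₚ p) p) (+ₚ-inverseʳ p)

scaleₚ-distribˡ : ∀ c p q → scaleₚ c (p +ₚ q) ≋ scaleₚ c p +ₚ scaleₚ c q
scaleₚ-distribˡ c p q .coeff-≡ i
  rewrite coeff-scaleₚ c (p +ₚ q) i | coeff-+ₚ p q i | coeff-+ₚ (scaleₚ c p) (scaleₚ c q) i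
        | coeff-scaleₚ c p i | coeff-scaleₚ c q i
  = ℤ.*-distribˡ-+ c (coeff p i) (coeff q i)

scaleₚ-distribʳ : ∀ c d p → scaleₚ (c ℤ.+ d) p ≋ scaleₚ c p +ₚ scaleₚ d p
scaleₚ-distribʳ c d p .coeff-≡ i
  rewrite coeff-scaleₚ (c ℤ.+ d) p i | coeff-+ₚ (scaleₚ c p) (scaleₚ d p) i
        | coeff-scaleₚ c p i | coeff-scaleₚ d p i
  = ℤ.*-distribʳ-+ (coeff p i) c d

scaleₚ-assoc : ∀ c d p → scaleₚ c (scaleₚ d p) ≋ scaleₚ (c ℤ.* d) p
scaleₚ-assoc c d p .coeff-≡ i
  rewrite coeff-scaleₚ c (scaleₚ d p) i | coeff-scaleₚ d p i | coeff-scaleₚ (c ℤ.* d) p i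
  = sym (ℤ.*-assoc c d (coeff p i))

scaleₚ-zero : ∀ p → scaleₚ (+ 0) p ≋ []
scaleₚ-zero p .coeff-≡ i rewrite coeff-scaleₚ (+ 0) p i = ℤ.*-zeroˡ (coeff p i)

scaleₚ-identity : ∀ p → scaleₚ (+ 1) p ≋ p
scaleₚ-identity p .coeff-≡ i rewrite coeff-scaleₚ (+ 1) p i = ℤ.*-identityˡ (coeff p i)

∷-cong : ∀ {a b p q} → a ≡ b → p ≋ q → (a ∷ p) ≋ (b ∷ q)
∷-cong a≡b p≋q .coeff-≡ zero    = a≡b
∷-cong a≡b p≋q .coeff-≡ (suc i) = coeff-≡ p≋q i

shift-cong : ∀ {p q} → p ≋ q → (+ 0 ∷ p) ≋ (+ 0 ∷ q)
shift-cong = ∷-cong refl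

shift-[] : (+ 0 ∷ []) ≋ []
shift-[] .coeff-≡ zero    = refl
shift-[] .coeff-≡ (suc i) = refl

scaleₚ-shift : ∀ c p → scaleₚ c (+ 0 ∷ p) ≋ (+ 0 ∷ scaleₚ c p)
scaleₚ-shift c p .coeff-≡ zero    = ℤ.*-zeroʳ c
scaleₚ-shift c p .coeff-≡ (suc i) = refl

+ₚ-interchange : ∀ p q r s → (p +ₚ q) +ₚ (r +ₚ s) ≋ (p +ₚ r) +ₚ (q +ₚ s)
+ₚ-interchange p q r s .coeff-≡ i
  rewrite coeff-+ₚ (p +ₚ q) (r +ₚ s) i | coeff-+ₚ p q i | coeff-+ₚ r s i
        | coeff-+ₚ (p +ₚ r) (q +ₚ s) i | coeff-+ₚ p r i | coeff-+ₚ q s i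
  = ℤ+.interchange (coeff p i) (coeff q i) (coeff r i) (coeff s i)

*ₚ-congˡ : ∀ p {q q′} → q ≋ q′ → p *ₚ q ≋ p *ₚ q′
*ₚ-congˡ []      e = ≋-refl
*ₚ-congˡ (a ∷ p) e = +ₚ-cong (scaleₚ-cong a e) (shift-cong (*ₚ-congˡ p e))

*ₚ-zeroʳ : ∀ p → p *ₚ [] ≋ []
*ₚ-zeroʳ []      = ≋-refl
*ₚ-zeroʳ (a ∷ p) = ≋-trans (shift-cong (*ₚ-zeroʳ p)) shift-[]

*ₚ-distribˡ : ∀ p q r → p *ₚ (q +ₚ r) ≋ p *ₚ q +ₚ p *ₚ r
*ₚ-distribˡ []      q r = ≋-refl
*ₚ-distribˡ (a ∷ p) q r =
  ≋-trans (+ₚ-cong (scaleₚ-distribˡ a q r) (shift-cong (*ₚ-distribˡ p q r)))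
          (+ₚ-interchange (scaleₚ a q) (scaleₚ a r) (+ 0 ∷ p *ₚ q) (+ 0 ∷ p *ₚ r))

*ₚ-distribʳ : ∀ p q r → (q +ₚ r) *ₚ p ≋ q *ₚ p +ₚ r *ₚ p
*ₚ-distribʳ p []      r       = ≋-refl
*ₚ-distribʳ p (a ∷ q) []      = ≋-sym (+ₚ-identityʳ _)
*ₚ-distribʳ p (a ∷ q) (b ∷ r) =
  ≋-trans (+ₚ-cong (scaleₚ-distribʳ a b p) (shift-cong (*ₚ-distribʳ p q r)))
          (+ₚ-interchange (scaleₚ a p) (scaleₚ b p) (+ 0 ∷ q *ₚ p) (+ 0 ∷ r *ₚ p))

*ₚ-identityˡ : ∀ p → constₚ (+ 1) *ₚ p ≋ p
*ₚ-identityˡ p = ≋-trans (+ₚ-cong (scaleₚ-identity p) shift-[]) (+ₚ-identityʳ p)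

*ₚ-shiftˡ : ∀ p q → (+ 0 ∷ p) *ₚ q ≋ (+ 0 ∷ p *ₚ q)
*ₚ-shiftˡ p q = +ₚ-cong (scaleₚ-zero q) ≋-refl

*ₚ-shiftʳ : ∀ p q → p *ₚ (+ 0 ∷ q) ≋ (+ 0 ∷ p *ₚ q)
*ₚ-shiftʳ []      q = ≋-sym shift-[]
*ₚ-shiftʳ (a ∷ p) q = +ₚ-cong (scaleₚ-shift a q) (shift-cong (*ₚ-shiftʳ p q))

*ₚ-constʳ : ∀ p b → p *ₚ constₚ b ≋ scaleₚ b p
*ₚ-constʳ []      b = ≋-refl
*ₚ-constʳ (a ∷ p) b .coeff-≡ zero    = trans (ℤ.+-identityʳ (a ℤ.* b)) (ℤ.*-comm a b)
*ₚ-constʳ (a ∷ p) b .coeff-≡ (suc i) = coeff-≡ (*ₚ-constʳ p b) i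

*ₚ-consʳ : ∀ p b q → p *ₚ (b ∷ q) ≋ scaleₚ b p +ₚ (+ 0 ∷ p *ₚ q)
*ₚ-consʳ p b q = begin
  p *ₚ (b ∷ q)                             ≈⟨ *ₚ-congˡ p split ⟩
  p *ₚ (constₚ b +ₚ (+ 0 ∷ q))             ≈⟨ *ₚ-distribˡ p (constₚ b) (+ 0 ∷ q) ⟩
  p *ₚ constₚ b +ₚ p *ₚ (+ 0 ∷ q)          ≈⟨ +ₚ-cong (*ₚ-constʳ p b) (*ₚ-shiftʳ p q) ⟩
  scaleₚ b p +ₚ (+ 0 ∷ p *ₚ q)             ∎
  where
  open ≋-Reasoning
  split : (b ∷ q) ≋ constₚ b +ₚ (+ 0 ∷ q)
  split .coeff-≡ zero    = sym (ℤ.+-identityʳ b)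
  split .coeff-≡ (suc i) = refl

*ₚ-comm : ∀ p q → p *ₚ q ≋ q *ₚ p
*ₚ-comm []      q = ≋-sym (*ₚ-zeroʳ q)
*ₚ-comm (a ∷ p) q = ≋-trans (+ₚ-cong ≋-refl (shift-cong (*ₚ-comm p q))) (≋-sym (*ₚ-consʳ q a p))

*ₚ-congʳ : ∀ p {q q′} → q ≋ q′ → q *ₚ p ≋ q′ *ₚ p
*ₚ-congʳ p {q} {q′} e = ≋-trans (*ₚ-comm q p) (≋-trans (*ₚ-congˡ p e) (*ₚ-comm p q′))

*ₚ-identityʳ : ∀ p → p *ₚ constₚ (+ 1) ≋ p
*ₚ-identityʳ p = ≋-trans (*ₚ-comm p (constₚ (+ 1))) (*ₚ-identityˡ p)

scaleₚ-*ₚ : ∀ c p q → scaleₚ c p *ₚ q ≋ scaleₚ c (p *ₚ q)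
scaleₚ-*ₚ c []      q = ≋-refl
scaleₚ-*ₚ c (a ∷ p) q =
  ≋-trans (+ₚ-cong (≋-sym (scaleₚ-assoc c a q)) (shift-cong (scaleₚ-*ₚ c p q)))
          (≋-sym (≋-trans (scaleₚ-distribˡ c (scaleₚ a q) (+ 0 ∷ p *ₚ q))
                          (+ₚ-cong ≋-refl (scaleₚ-shift c (p *ₚ q)))))

*ₚ-assoc : ∀ p q r → (p *ₚ q) *ₚ r ≋ p *ₚ (q *ₚ r)
*ₚ-assoc []      q r = ≋-refl
*ₚ-assoc (a ∷ p) q r =
  ≋-trans (*ₚ-distribʳ r (scaleₚ a q) (+ 0 ∷ p *ₚ q))
          (+ₚ-cong (scaleₚ-*ₚ a q r) (≋-trans (*ₚ-shiftˡ (p *ₚ q) r) (shift-cong (*ₚ-assoc p q r))))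

*ₚ-cong : ∀ {p p′ q q′} → p ≋ p′ → q ≋ q′ → p *ₚ q ≋ p′ *ₚ q′
*ₚ-cong {p} {p′} {q} e f = ≋-trans (*ₚ-congʳ q e) (*ₚ-congˡ p′ f)

-ₚ-cong : ∀ {p p′ q q′} → p ≋ p′ → q ≋ q′ → p -ₚ q ≋ p′ -ₚ q′
-ₚ-cong e f = +ₚ-cong e (scaleₚ-cong (ℤ.- + 1) f)

ℤ[X]-isCommutativeRing : IsCommutativeRing _≋_ _+ₚ_ _*ₚ_ negₚ [] (constₚ (+ 1))
ℤ[X]-isCommutativeRing = record
  { isRing = record
    { +-isAbelianGroup = record
      { isGroup = record
        { isMonoid = record
          { isSemigroup = record
            { isMagma = record
              { isEquivalence = Setoid.isEquivalence ≋-setoid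
              ; ∙-cong        = +ₚ-cong
              }
            ; assoc = +ₚ-assoc
            }
          ; identity = +ₚ-identityˡ , +ₚ-identityʳ
          }
        ; inverse = +ₚ-inverseˡ , +ₚ-inverseʳ
        ; ⁻¹-cong = scaleₚ-cong (ℤ.- + 1)
        }
      ; comm = +ₚ-comm
      }
    ; *-cong     = *ₚ-cong
    ; *-assoc    = *ₚ-assoc
    ; *-identity = *ₚ-identityˡ , *ₚ-identityʳ
    ; distrib    = *ₚ-distribˡ , *ₚ-distribʳ
    }
  ; *-comm = *ₚ-comm
  }

ℤ[X] : CommutativeRing 0ℓ 0ℓ
ℤ[X] = record { isCommutativeRing = ℤ[X]-isCommutativeRing }

isZero? : ∀ p → Maybe ([] ≋ p)
isZero? []          = just ≋-refl
isZero? (+ 0 ∷ p)   with isZero? p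
... | just e  = just (≋-trans (≋-sym shift-[]) (shift-cong e))
... | nothing = nothing
isZero? (_ ∷ _)     = nothing

ℤ[X]-acr : AlmostCommutativeRing 0ℓ 0ℓ
ℤ[X]-acr = fromCommutativeRing ℤ[X] isZero?

constₚ-* : ∀ a b → constₚ (a ℤ.* b) ≋ constₚ a *ₚ constₚ b
constₚ-* a b .coeff-≡ zero    = sym (ℤ.+-identityʳ (a ℤ.* b))
constₚ-* a b .coeff-≡ (suc i) = refl

constₚ-neg : ∀ a → constₚ (ℤ.- a) ≋ negₚ (constₚ a)
constₚ-neg a .coeff-≡ zero    = sym (ℤ.-1*i≡-i a)
constₚ-neg a .coeff-≡ (suc i) = refl

constₚ-zero : constₚ (+ 0) ≋ []
constₚ-zero = shift-[]

scaleₚ≋constₚ*ₚ : ∀ c p → scaleₚ c p ≋ constₚ c *ₚ p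
scaleₚ≋constₚ*ₚ c p = ≋-sym (≋-trans (+ₚ-cong ≋-refl shift-[]) (+ₚ-identityʳ (scaleₚ c p)))

monoₚ-+ : ∀ a b → monoₚ (a ℕ.+ b) ≋ monoₚ a *ₚ monoₚ b
monoₚ-+ zero    b = ≋-sym (*ₚ-identityˡ (monoₚ b))
monoₚ-+ (suc a) b = ≋-trans (shift-cong (monoₚ-+ a b)) (≋-sym (*ₚ-shiftˡ (monoₚ a) (monoₚ b)))

-- Divisibility and congruences modulo a polynomial

open import Algebra.Properties.Semiring.Divisibility (CommutativeRing.semiring ℤ[X])
  using (_,_; ∣ʳ-refl; ∣ʳ-reflexive; ∣ʳ-trans; ∣ʳ-respʳ-≈; ∣ʳ-respˡ-≈; x∣ʳyx; x∣ʳy⇒x∣ʳzy; _∣0)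
  renaming (_∣_ to _∣ₚ_)
open import Algebra.Properties.CommutativeSemigroup.Divisibility (CommutativeRing.*-commutativeSemigroup ℤ[X])
  using (∙-cong-∣)

∣ₚ-+ : ∀ {h p q} → h ∣ₚ p → h ∣ₚ q → h ∣ₚ p +ₚ q
∣ₚ-+ {h} (u , uh≋p) (v , vh≋q) = u +ₚ v , ≋-trans (*ₚ-distribʳ h u v) (+ₚ-cong uh≋p vh≋q)

∣ₚ-neg : ∀ {h p} → h ∣ₚ p → h ∣ₚ negₚ p
∣ₚ-neg {h} (u , uh≋p) = negₚ u , ≋-trans (scaleₚ-*ₚ (ℤ.- + 1) u h) (scaleₚ-cong (ℤ.- + 1) uh≋p)

∣ₚ-*ₚʳ : ∀ {h g} k → h ∣ₚ g → h ∣ₚ g *ₚ k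
∣ₚ-*ₚʳ {h} {g} k h∣g = ∣ʳ-respʳ-≈ (*ₚ-comm k g) (x∣ʳy⇒x∣ʳzy k h∣g)

infix 4 _≈_mod_
record _≈_mod_ (p q h : Poly) : Set where
  constructor divides-difference
  field difference-divisible : h ∣ₚ p -ₚ q
open _≈_mod_ public

module _ {h : Poly} where

  private
    sub-self : ∀ p → p -ₚ p ≋ []
    sub-self = solve-∀ ℤ[X]-acr
    sub-swap : ∀ p q → negₚ (p -ₚ q) ≋ q -ₚ p
    sub-swap = solve-∀ ℤ[X]-acr
    sub-chain : ∀ p q r → (p -ₚ q) +ₚ (q -ₚ r) ≋ p -ₚ r
    sub-chain = solve-∀ ℤ[X]-acr
    sub-+ : ∀ p p′ q q′ → (p -ₚ p′) +ₚ (q -ₚ q′) ≋ (p +ₚ q) -ₚ (p′ +ₚ q′)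
    sub-+ = solve-∀ ℤ[X]-acr
    sub-* : ∀ p p′ q q′ → p *ₚ (q -ₚ q′) +ₚ q′ *ₚ (p -ₚ p′) ≋ p *ₚ q -ₚ p′ *ₚ q′
    sub-* = solve-∀ ℤ[X]-acr
    sub-neg : ∀ p q → negₚ (p -ₚ q) ≋ negₚ p -ₚ negₚ q
    sub-neg = solve-∀ ℤ[X]-acr

  ≋⇒≈mod : ∀ {p q} → p ≋ q → p ≈ q mod h
  ≋⇒≈mod {p} {q} p≋q = divides-difference ([] , ≋-sym (≋-trans (+ₚ-cong p≋q ≋-refl) (sub-self q)))

  ≈mod-refl : ∀ {p} → p ≈ p mod h
  ≈mod-refl = ≋⇒≈mod ≋-refl

  ≈mod-sym : ∀ {p q} → p ≈ q mod h → q ≈ p mod h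
  ≈mod-sym {p} {q} (divides-difference d) = divides-difference (∣ʳ-respʳ-≈ (sub-swap p q) (∣ₚ-neg d))

  ≈mod-trans : ∀ {p q r} → p ≈ q mod h → q ≈ r mod h → p ≈ r mod h
  ≈mod-trans {p} {q} {r} (divides-difference d) (divides-difference e) =
    divides-difference (∣ʳ-respʳ-≈ (sub-chain p q r) (∣ₚ-+ d e))

  +ₚ-cong-mod : ∀ {p p′ q q′} → p ≈ p′ mod h → q ≈ q′ mod h → p +ₚ q ≈ p′ +ₚ q′ mod h
  +ₚ-cong-mod {p} {p′} {q} {q′} (divides-difference d) (divides-difference e) =
    divides-difference (∣ʳ-respʳ-≈ (sub-+ p p′ q q′) (∣ₚ-+ d e))

  *ₚ-cong-mod : ∀ {p p′ q q′} → p ≈ p′ mod h → q ≈ q′ mod h → p *ₚ q ≈ p′ *ₚ q′ mod h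
  *ₚ-cong-mod {p} {p′} {q} {q′} (divides-difference d) (divides-difference e) =
    divides-difference (∣ʳ-respʳ-≈ (sub-* p p′ q q′) (∣ₚ-+ (x∣ʳy⇒x∣ʳzy p e) (x∣ʳy⇒x∣ʳzy q′ d)))

  negₚ-cong-mod : ∀ {p q} → p ≈ q mod h → negₚ p ≈ negₚ q mod h
  negₚ-cong-mod {p} {q} (divides-difference d) = divides-difference (∣ʳ-respʳ-≈ (sub-neg p q) (∣ₚ-neg d))

≈mod-setoid : Poly → Setoid 0ℓ 0ℓ
≈mod-setoid h = record
  { Carrier       = Poly
  ; _≈_           = _≈_mod h
  ; isEquivalence = record { refl = ≈mod-refl ; sym = ≈mod-sym ; trans = ≈mod-trans }
  }

module ≈mod-Reasoning (h : Poly) = SetoidReasoning (≈mod-setoid h)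

≈mod-weaken : ∀ {h h′ p q} → h′ ∣ₚ h → p ≈ q mod h → p ≈ q mod h′
≈mod-weaken h′∣h (divides-difference h∣p-q) = divides-difference (∣ʳ-trans h′∣h h∣p-q)

∣ₚ⇒≈[] : ∀ {h p} → h ∣ₚ p → p ≈ [] mod h
∣ₚ⇒≈[] {h} {p} h∣p = divides-difference (∣ʳ-respʳ-≈ (≋-sym (+ₚ-identityʳ p)) h∣p)

ConstantMod : Poly → Poly → Set
ConstantMod h p = ∃ λ c → p ≈ constₚ c mod h

ConstantMod-zero : ∀ {h p} → p ≋ [] → ConstantMod h p
ConstantMod-zero p≋[] = + 0 , ≋⇒≈mod (≋-trans p≋[] (≋-sym constₚ-zero))

ConstantMod-resp : ∀ {h p q} → p ≈ q mod h → ConstantMod h q → ConstantMod h p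
ConstantMod-resp p≈q (c , q≈c) = c , ≈mod-trans p≈q q≈c

ConstantMod-+ₚ : ∀ {h p q} → ConstantMod h p → ConstantMod h q → ConstantMod h (p +ₚ q)
ConstantMod-+ₚ (c , p≈c) (d , q≈d) = c ℤ.+ d , +ₚ-cong-mod p≈c q≈d

ConstantMod-negₚ : ∀ {h p} → ConstantMod h p → ConstantMod h (negₚ p)
ConstantMod-negₚ (c , p≈c) = ℤ.- c , ≈mod-trans (negₚ-cong-mod p≈c) (≋⇒≈mod (≋-sym (constₚ-neg c)))

-- Monic polynomials and exact division

data Monic : Poly → Set where
  monic : ∀ xs → Monic (xs ++ + 1 ∷ [])

degree : ∀ {p} → Monic p → ℕ
degree (monic xs) = length xs

DegreeBelow : ℕ → Poly → Set
DegreeBelow d r = ∀ i → d ℕ.≤ i → coeff r i ≡ + 0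

coeff-beyond-length : ∀ xs i → length xs ℕ.≤ i → coeff xs i ≡ + 0
coeff-beyond-length []       i       _         = refl
coeff-beyond-length (x ∷ xs) (suc i) (s≤s le) = coeff-beyond-length xs i le

coeff-++ʳ : ∀ xs ys i → coeff (xs ++ ys) (length xs ℕ.+ i) ≡ coeff ys i
coeff-++ʳ []       ys i = refl
coeff-++ʳ (x ∷ xs) ys i = coeff-++ʳ xs ys i

monic-leading : ∀ {h} (m : Monic h) → coeff h (degree m) ≡ + 1
monic-leading (monic xs) =
  subst (λ i → coeff (xs ++ + 1 ∷ []) i ≡ + 1) (ℕ.+-identityʳ (length xs)) (coeff-++ʳ xs (+ 1 ∷ []) 0)

monic-beyond : ∀ {h} (m : Monic h) → DegreeBelow (suc (degree m)) h
monic-beyond (monic xs) i lt = coeff-beyond-length (xs ++ + 1 ∷ []) i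
  (subst (ℕ._≤ i) (sym (trans (length-++ xs) (ℕ.+-comm (length xs) 1))) lt)

+ₚ-[] : ∀ p → p +ₚ [] ≡ p
+ₚ-[] []      = refl
+ₚ-[] (a ∷ p) = refl

+ₚ-++-[c] : ∀ u v c → length u ℕ.≤ length v → u +ₚ (v ++ c ∷ []) ≡ (u +ₚ v) ++ c ∷ []
+ₚ-++-[c] []      v       c _        = refl
+ₚ-++-[c] (a ∷ u) (b ∷ v) c (s≤s le) = cong (a ℤ.+ b ∷_) (+ₚ-++-[c] u v c le)

length-+ₚ : ∀ u v → length u ℕ.≤ length v → length (u +ₚ v) ≡ length v
length-+ₚ []      v       _        = refl
length-+ₚ (a ∷ u) (b ∷ v) (s≤s le) = cong suc (length-+ₚ u v le)

++-[1]-*ₚ-++-[1] : ∀ xs ys → ∃ λ zs → (xs ++ + 1 ∷ []) *ₚ (ys ++ + 1 ∷ []) ≡ zs ++ + 1 ∷ []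
                                    × length zs ≡ length xs ℕ.+ length ys
++-[1]-*ₚ-++-[1] []      []       = [] , refl , refl
++-[1]-*ₚ-++-[1] []      (y ∷ ys) =
  _ , cong (_ ∷_) (trans (+ₚ-[] _) (map-++ (+ 1 ℤ.*_) ys (+ 1 ∷ []))) , cong suc (length-map _ ys)
++-[1]-*ₚ-++-[1] (a ∷ xs) ys with ++-[1]-*ₚ-++-[1] xs ys
... | ws , eq , |ws| = scaleₚ a q +ₚ (+ 0 ∷ ws) ,
      trans (cong (λ z → scaleₚ a q +ₚ (+ 0 ∷ z)) eq) (+ₚ-++-[c] (scaleₚ a q) (+ 0 ∷ ws) (+ 1) |aq|≤) ,
      trans (length-+ₚ (scaleₚ a q) (+ 0 ∷ ws) |aq|≤) (cong suc |ws|)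
  where
  q = ys ++ + 1 ∷ []
  |aq|≤ : length (scaleₚ a q) ℕ.≤ suc (length ws)
  |aq|≤ = begin
    length (scaleₚ a q)       ≡⟨ length-map (a ℤ.*_) q ⟩
    length q                  ≡⟨ trans (length-++ ys) (ℕ.+-comm (length ys) 1) ⟩
    suc (length ys)           ≤⟨ s≤s (ℕ.m≤n+m (length ys) (length xs)) ⟩
    suc (length xs ℕ.+ length ys) ≡⟨ cong suc |ws| ⟨
    suc (length ws)           ∎
    where open ℕ.≤-Reasoning

Monic-*ₚ : ∀ {p q} → Monic p → Monic q → Monic (p *ₚ q)
Monic-*ₚ (monic xs) (monic ys) with ++-[1]-*ₚ-++-[1] xs ys
... | zs , eq , _ = subst Monic (sym eq) (monic zs)

Monic-XN-1 : ∀ n → Monic (XN-1 (suc n))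
Monic-XN-1 n = subst Monic (cong (_ ∷_) (sym (+ₚ-[] _))) (monic (ℤ.- + 1 ∷ replicate n (+ 0)))

*ₚ-monic-degreeBelow⇒≋[] : ∀ {h} (m : Monic h) s → DegreeBelow (degree m) (h *ₚ s) → s ≋ []
*ₚ-monic-degreeBelow⇒≋[] m []      low = ≋-refl
*ₚ-monic-degreeBelow⇒≋[] {h} m (c ∷ s) low = c∷s≋[]
  where
  coeff-h*c∷s : ∀ i → coeff (h *ₚ (c ∷ s)) i ≡ c ℤ.* coeff h i ℤ.+ coeff (+ 0 ∷ h *ₚ s) i
  coeff-h*c∷s i = trans (coeff-≡ (*ₚ-consʳ h c s) i)
    (trans (coeff-+ₚ (scaleₚ c h) _ i) (cong (ℤ._+ _) (coeff-scaleₚ c h i)))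
  s≋[] : s ≋ []
  s≋[] = *ₚ-monic-degreeBelow⇒≋[] m s λ j d≤j → begin
    coeff (h *ₚ s) j                                   ≡⟨ trans (cong (ℤ._+ coeff (h *ₚ s) j) (ℤ.*-zeroʳ c)) (ℤ.+-identityˡ _) ⟨
    c ℤ.* + 0 ℤ.+ coeff (h *ₚ s) j                     ≡⟨ cong (λ z → c ℤ.* z ℤ.+ coeff (h *ₚ s) j) (monic-beyond m (suc j) (s≤s d≤j)) ⟨
    c ℤ.* coeff h (suc j) ℤ.+ coeff (h *ₚ s) j         ≡⟨ coeff-h*c∷s (suc j) ⟨
    coeff (h *ₚ (c ∷ s)) (suc j)                       ≡⟨ low (suc j) (ℕ.m≤n⇒m≤1+n d≤j) ⟩
    + 0                                                ∎
    where open ≡-Reasoning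
  shifted-h*s≋[] : (+ 0 ∷ h *ₚ s) ≋ []
  shifted-h*s≋[] = ≋-trans (shift-cong (≋-trans (*ₚ-congˡ h s≋[]) (*ₚ-zeroʳ h))) shift-[]
  c≡0 : c ≡ + 0
  c≡0 = begin
    c                                                  ≡⟨ trans (ℤ.+-identityʳ _) (ℤ.*-identityʳ c) ⟨
    c ℤ.* + 1 ℤ.+ + 0                                  ≡⟨ cong₂ (λ u v → c ℤ.* u ℤ.+ v) (monic-leading m) (coeff-≡ shifted-h*s≋[] (degree m)) ⟨
    c ℤ.* coeff h (degree m) ℤ.+ coeff (+ 0 ∷ h *ₚ s) (degree m)  ≡⟨ coeff-h*c∷s (degree m) ⟨
    coeff (h *ₚ (c ∷ s)) (degree m)                    ≡⟨ low (degree m) ℕ.≤-refl ⟩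
    + 0                                                ∎
    where open ≡-Reasoning
  c∷s≋[] : (c ∷ s) ≋ []
  c∷s≋[] .coeff-≡ zero    = c≡0
  c∷s≋[] .coeff-≡ (suc i) = coeff-≡ s≋[] i

monic-*ₚ-cancelˡ : ∀ {h} → Monic h → ∀ u v → h *ₚ u ≋ h *ₚ v → u ≋ v
monic-*ₚ-cancelˡ {h} m u v hu≋hv =
  ≋-trans (u≋u-v+v u v) (≋-trans (+ₚ-cong u-v≋[] ≋-refl) (+ₚ-identityˡ v))
  where
  u≋u-v+v : ∀ u v → u ≋ (u -ₚ v) +ₚ v
  u≋u-v+v = solve-∀ ℤ[X]-acr
  h*[u-v] : ∀ h u v → h *ₚ (u -ₚ v) ≋ h *ₚ u -ₚ h *ₚ v
  h*[u-v] = solve-∀ ℤ[X]-acr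
  u-v≋[] : u -ₚ v ≋ []
  u-v≋[] = *ₚ-monic-degreeBelow⇒≋[] m (u -ₚ v) λ i _ →
    coeff-≡ (≋-trans (h*[u-v] h u v) (≋-trans (+ₚ-cong hu≋hv ≋-refl) (+ₚ-inverseʳ (h *ₚ v)))) i

-- Defs keeps the long-division loop of divMonic and its subtraction helper private. These
-- metavariables are solved by unification against them (the withs generalise the arguments, and
-- reverse itself, so that the problems are patterns), which gives names to reason about the loop.
private mutual
  divLoop : List ℤ → ℕ → List ℤ → List ℤ
  divLoop = _

  subPrefix : List ℤ → List ℤ → List ℤ
  subPrefix = _

  divMonic-unfold : ∀ a xs → divMonic a (xs ++ + 1 ∷ []) ≡ reverse (divLoop (reverse xs) (length a) (reverse a))
  divMonic-unfold a xs rewrite reverse-++ xs (+ 1 ∷ []) with length a | reverse a | reverse xs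
  ... | f | g | bt with reverse {A = ℤ}
  ...   | rev = refl

  divLoop-long : ∀ bt f c a → length bt ℕ.≤ length a →
                 divLoop bt (suc f) (c ∷ a) ≡ c ∷ divLoop bt f (subPrefix a (scaleₚ c bt))
  divLoop-long bt f c a le with length a <ᵇ length bt in short
  ... | true  = ⊥-elim (ℕ.<⇒≱ (ℕ.<ᵇ⇒< (length a) (length bt) (subst T (sym short) _)) le)
  ... | false with scaleₚ c bt
  ...   | ys = refl

divLoop-short : ∀ bt f c a → length a ℕ.< length bt → divLoop bt (suc f) (c ∷ a) ≡ []
divLoop-short bt f c a lt with length a <ᵇ length bt in short
... | true  = refl
... | false = ⊥-elim (subst T short (ℕ.<⇒<ᵇ lt))

divLoop-leading-one : ∀ bt f t → divLoop bt (suc f) (+ 1 ∷ t) ≡ []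
                                ⊎ ∃ λ Q → divLoop bt (suc f) (+ 1 ∷ t) ≡ + 1 ∷ Q
divLoop-leading-one bt f t with length t ℕ.<? length bt
... | yes lt = inj₁ (divLoop-short bt f (+ 1) t lt)
... | no ¬lt = inj₂ (_ , divLoop-long bt f (+ 1) t (ℕ.≮⇒≥ ¬lt))

++-[c] : ∀ xs c → xs ++ c ∷ [] ≋ xs +ₚ constₚ c *ₚ monoₚ (length xs)
++-[c] []       c = ≋-sym (*ₚ-identityʳ (constₚ c))
++-[c] (x ∷ xs) c = begin
  x ∷ (xs ++ c ∷ [])                                   ≈⟨ ∷-cong (sym (ℤ.+-identityʳ x)) (++-[c] xs c) ⟩
  (x ∷ xs) +ₚ (+ 0 ∷ constₚ c *ₚ monoₚ (length xs))    ≈⟨ +ₚ-cong (≋-refl {x ∷ xs}) (*ₚ-shiftʳ (constₚ c) (monoₚ (length xs))) ⟨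
  (x ∷ xs) +ₚ constₚ c *ₚ monoₚ (suc (length xs))      ∎
  where open ≋-Reasoning

reverse-∷ : ∀ c a → reverse (c ∷ a) ≋ reverse a +ₚ constₚ c *ₚ monoₚ (length a)
reverse-∷ c a rewrite unfold-reverse c a | sym (length-reverse a) = ++-[c] (reverse a) c

subPrefix-length : ∀ xs ys → length ys ℕ.≤ length xs → length (subPrefix xs ys) ≡ length xs
subPrefix-length xs       []       _        = refl
subPrefix-length (x ∷ xs) (y ∷ ys) (s≤s le) = cong suc (subPrefix-length xs ys le)

subPrefix-reverse : ∀ xs ys → length ys ℕ.≤ length xs →
                    reverse xs ≋ reverse (subPrefix xs ys) +ₚ monoₚ (length xs ∸ length ys) *ₚ reverse ys
subPrefix-reverse xs [] _ =
  ≋-sym (≋-trans (+ₚ-cong (≋-refl {reverse xs}) (*ₚ-zeroʳ (monoₚ (length xs)))) (+ₚ-identityʳ (reverse xs)))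
subPrefix-reverse (x ∷ xs) (y ∷ ys) (s≤s le) = begin
  reverse (x ∷ xs)                                     ≈⟨ reverse-∷ x xs ⟩
  R +ₚ x̂ *ₚ monoₚ (length xs)                          ≈⟨ +ₚ-cong (subPrefix-reverse xs ys le) (*ₚ-congˡ x̂ Xⁿ≋XᵏXᵐ) ⟩
  (S +ₚ Xᵏ *ₚ Q) +ₚ x̂ *ₚ (Xᵏ *ₚ Xᵐ)                    ≈⟨ regroup S Q Xᵏ Xᵐ x̂ ŷ ⟩
  (S +ₚ (x̂ -ₚ ŷ) *ₚ (Xᵏ *ₚ Xᵐ)) +ₚ Xᵏ *ₚ (Q +ₚ ŷ *ₚ Xᵐ) ≈⟨ +ₚ-cong (+ₚ-cong (≋-refl {S}) (*ₚ-cong const-diff |S|-monomial))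
                                                                (*ₚ-congˡ Xᵏ (reverse-∷ y ys)) ⟨
  (S +ₚ constₚ (x ℤ.- y) *ₚ monoₚ (length (subPrefix xs ys))) +ₚ Xᵏ *ₚ reverse (y ∷ ys)
                                                       ≈⟨ +ₚ-cong (reverse-∷ (x ℤ.- y) (subPrefix xs ys)) ≋-refl ⟨
  reverse ((x ℤ.- y) ∷ subPrefix xs ys) +ₚ Xᵏ *ₚ reverse (y ∷ ys) ∎
  where
  open ≋-Reasoning
  R = reverse xs
  S = reverse (subPrefix xs ys)
  Q = reverse ys
  Xᵏ = monoₚ (length xs ∸ length ys)
  Xᵐ = monoₚ (length ys)
  x̂ = constₚ x
  ŷ = constₚ y
  Xⁿ≋XᵏXᵐ : monoₚ (length xs) ≋ Xᵏ *ₚ Xᵐ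
  Xⁿ≋XᵏXᵐ = ≋-trans (≡⇒≋ (cong monoₚ (sym (ℕ.m∸n+n≡m le)))) (monoₚ-+ (length xs ∸ length ys) (length ys))
  |S|-monomial : monoₚ (length (subPrefix xs ys)) ≋ Xᵏ *ₚ Xᵐ
  |S|-monomial = ≋-trans (≡⇒≋ (cong monoₚ (subPrefix-length xs ys le))) Xⁿ≋XᵏXᵐ
  const-diff : constₚ (x ℤ.- y) ≋ x̂ -ₚ ŷ
  const-diff = ∷-cong (cong (λ z → x ℤ.+ z) (sym (ℤ.-1*i≡-i y))) ≋-refl
  regroup : ∀ S Q Xᵏ Xᵐ x̂ ŷ → (S +ₚ Xᵏ *ₚ Q) +ₚ x̂ *ₚ (Xᵏ *ₚ Xᵐ)
                             ≋ (S +ₚ (x̂ -ₚ ŷ) *ₚ (Xᵏ *ₚ Xᵐ)) +ₚ Xᵏ *ₚ (Q +ₚ ŷ *ₚ Xᵐ)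
  regroup = solve-∀ ℤ[X]-acr

-- Lists are read highest coefficient first here, as divLoop consumes them; bt is the divisor
-- without its leading 1.
longDivision-step : ∀ {bt c a Q r} → length bt ℕ.≤ length a → length Q ≡ length a ∸ length bt →
                    reverse (subPrefix a (scaleₚ c bt)) ≋ reverse Q *ₚ reverse (+ 1 ∷ bt) +ₚ r →
                    reverse (c ∷ a) ≋ reverse (c ∷ Q) *ₚ reverse (+ 1 ∷ bt) +ₚ r
longDivision-step {bt} {c} {a} {Q} {r} bt≤a |Q|≡k division = begin
  reverse (c ∷ a)                                      ≈⟨ reverse-∷ c a ⟩
  reverse a +ₚ ĉ *ₚ monoₚ (length a)                   ≈⟨ +ₚ-cong reverse-a (*ₚ-congˡ ĉ Xᵃ≋XᵏXᵈ) ⟩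
  (reverse M +ₚ Xᵏ *ₚ (ĉ *ₚ RB)) +ₚ ĉ *ₚ (Xᵏ *ₚ Xᵈ)   ≈⟨ +ₚ-cong (+ₚ-cong division′ ≋-refl) ≋-refl ⟩
  ((RQ *ₚ (RB +ₚ Xᵈ) +ₚ r) +ₚ Xᵏ *ₚ (ĉ *ₚ RB)) +ₚ ĉ *ₚ (Xᵏ *ₚ Xᵈ)
                                                       ≈⟨ regroup RQ r ĉ Xᵏ RB Xᵈ ⟩
  (RQ +ₚ ĉ *ₚ Xᵏ) *ₚ (RB +ₚ Xᵈ) +ₚ r                   ≈⟨ +ₚ-cong (*ₚ-cong (+ₚ-cong (≋-refl {RQ}) (*ₚ-congˡ ĉ Xᵏ≋X^|Q|))
                                                                          (≋-sym B≋RB+Xᵈ)) ≋-refl ⟩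
  (RQ +ₚ ĉ *ₚ monoₚ (length Q)) *ₚ reverse (+ 1 ∷ bt) +ₚ r
                                                       ≈⟨ +ₚ-cong (*ₚ-congʳ (reverse (+ 1 ∷ bt)) (reverse-∷ c Q)) ≋-refl ⟨
  reverse (c ∷ Q) *ₚ reverse (+ 1 ∷ bt) +ₚ r           ∎
  where
  open ≋-Reasoning
  d = length bt
  k = length a ∸ d
  M = subPrefix a (scaleₚ c bt)
  ĉ = constₚ c
  Xᵏ = monoₚ k
  Xᵈ = monoₚ d
  RB = reverse bt
  RQ = reverse Q
  |cbt|≡d : length (scaleₚ c bt) ≡ d
  |cbt|≡d = length-map (c ℤ.*_) bt
  B≋RB+Xᵈ : reverse (+ 1 ∷ bt) ≋ RB +ₚ Xᵈ
  B≋RB+Xᵈ = ≋-trans (reverse-∷ (+ 1) bt) (+ₚ-cong (≋-refl {RB}) (*ₚ-identityˡ Xᵈ))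
  reverse-a : reverse a ≋ reverse M +ₚ Xᵏ *ₚ (ĉ *ₚ RB)
  reverse-a = ≋-trans (subPrefix-reverse a (scaleₚ c bt) (subst (ℕ._≤ length a) (sym |cbt|≡d) bt≤a))
    (+ₚ-cong (≋-refl {reverse M}) (*ₚ-cong (≡⇒≋ (cong (λ n → monoₚ (length a ∸ n)) |cbt|≡d))
                                          (≋-trans (≡⇒≋ (sym (reverse-map (c ℤ.*_) bt))) (scaleₚ≋constₚ*ₚ c RB))))
  Xᵃ≋XᵏXᵈ : monoₚ (length a) ≋ Xᵏ *ₚ Xᵈ
  Xᵃ≋XᵏXᵈ = ≋-trans (≡⇒≋ (cong monoₚ (sym (ℕ.m∸n+n≡m bt≤a)))) (monoₚ-+ k d)
  division′ : reverse M ≋ RQ *ₚ (RB +ₚ Xᵈ) +ₚ r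
  division′ = ≋-trans division (+ₚ-cong (*ₚ-congˡ RQ B≋RB+Xᵈ) ≋-refl)
  Xᵏ≋X^|Q| : Xᵏ ≋ monoₚ (length Q)
  Xᵏ≋X^|Q| = ≡⇒≋ (cong monoₚ (sym |Q|≡k))
  regroup : ∀ RQ r ĉ Xᵏ RB Xᵈ → ((RQ *ₚ (RB +ₚ Xᵈ) +ₚ r) +ₚ Xᵏ *ₚ (ĉ *ₚ RB)) +ₚ ĉ *ₚ (Xᵏ *ₚ Xᵈ)
                               ≋ (RQ +ₚ ĉ *ₚ Xᵏ) *ₚ (RB +ₚ Xᵈ) +ₚ r
  regroup = solve-∀ ℤ[X]-acr

DivisionOf : List ℤ → List ℤ → List ℤ → Set
DivisionOf bt g q = Σ Poly λ r → (reverse g ≋ reverse q *ₚ reverse (+ 1 ∷ bt) +ₚ r) × DegreeBelow (length bt) r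
                               × length q ≡ length g ∸ length bt

divLoop-division : ∀ bt f g → length g ℕ.≤ f → DivisionOf bt g (divLoop bt f g)
divLoop-division bt zero    []      _ = [] , ≋-refl , (λ _ _ → refl) , sym (ℕ.0∸n≡0 (length bt))
divLoop-division bt (suc f) []      _ = [] , ≋-refl , (λ _ _ → refl) , sym (ℕ.0∸n≡0 (length bt))
divLoop-division bt (suc f) (c ∷ a) (s≤s a≤f) with length a ℕ.<? length bt
... | yes a<bt rewrite divLoop-short bt f c a a<bt =
  reverse (c ∷ a) , ≋-refl ,
  (λ i bt≤i → coeff-beyond-length (reverse (c ∷ a)) i
                (ℕ.≤-trans (ℕ.≤-reflexive (length-reverse (c ∷ a))) (ℕ.≤-trans a<bt bt≤i))) ,
  sym (ℕ.m≤n⇒m∸n≡0 a<bt)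
... | no a≮bt rewrite divLoop-long bt f c a (ℕ.≮⇒≥ a≮bt) =
  r , longDivision-step {bt} {c} {a} {divLoop bt f (subPrefix a (scaleₚ c bt))} bt≤a |Q|≡k division , low ,
  trans (cong suc |Q|≡k) (sym (ℕ.+-∸-assoc 1 bt≤a))
  where
  bt≤a = ℕ.≮⇒≥ a≮bt
  |M|≡|a| : length (subPrefix a (scaleₚ c bt)) ≡ length a
  |M|≡|a| = subPrefix-length a (scaleₚ c bt) (subst (ℕ._≤ length a) (sym (length-map (c ℤ.*_) bt)) bt≤a)
  ih = divLoop-division bt f (subPrefix a (scaleₚ c bt)) (subst (ℕ._≤ f) (sym |M|≡|a|) a≤f)
  r = proj₁ ih
  division = proj₁ (proj₂ ih)
  low = proj₁ (proj₂ (proj₂ ih))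
  |Q|≡k = trans (proj₂ (proj₂ (proj₂ ih))) (cong (_∸ length bt) |M|≡|a|)

divMonic-division : ∀ {b} (m : Monic b) a →
                    Σ Poly λ r → (a ≋ divMonic a b *ₚ b +ₚ r) × DegreeBelow (degree m) r
divMonic-division (monic xs) a
  with divLoop-division (reverse xs) (length a) (reverse a) (ℕ.≤-reflexive (length-reverse a))
... | r , division , low , _ = r , a≋qb+r , λ i → low i ∘ ℕ.≤-trans (ℕ.≤-reflexive (length-reverse xs))
  where
  b≡ : reverse (+ 1 ∷ reverse xs) ≡ xs ++ + 1 ∷ []
  b≡ = trans (unfold-reverse (+ 1) (reverse xs)) (cong (_++ + 1 ∷ []) (reverse-involutive xs))
  a≋qb+r : a ≋ divMonic a (xs ++ + 1 ∷ []) *ₚ (xs ++ + 1 ∷ []) +ₚ r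
  a≋qb+r rewrite divMonic-unfold a xs | sym b≡ =
    subst (λ g → g ≋ reverse (divLoop (reverse xs) (length a) (reverse a)) *ₚ reverse (+ 1 ∷ reverse xs) +ₚ r)
          (reverse-involutive a) division

divMonic-exact : ∀ {a b} → Monic b → b ∣ₚ a → divMonic a b *ₚ b ≋ a
divMonic-exact {a} {b} m (G , Gb≋a) with divMonic-division m a
... | r , a≋qb+r , low = ≋-sym (≋-trans a≋qb+r (≋-trans (+ₚ-cong ≋-refl r≋[]) (+ₚ-identityʳ (q *ₚ b))))
  where
  q = divMonic a b
  r≋b[G-q] : r ≋ b *ₚ (G -ₚ q)
  r≋b[G-q] = ≋-trans (isolate b q r) (≋-trans (-ₚ-cong (≋-sym (≋-trans Gb≋a a≋qb+r)) ≋-refl) (factor b G q))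
    where
    isolate : ∀ b q r → r ≋ (q *ₚ b +ₚ r) -ₚ q *ₚ b
    isolate = solve-∀ ℤ[X]-acr
    factor : ∀ b G q → G *ₚ b -ₚ q *ₚ b ≋ b *ₚ (G -ₚ q)
    factor = solve-∀ ℤ[X]-acr
  r≋[] : r ≋ []
  r≋[] = ≋-trans r≋b[G-q] (≋-trans (*ₚ-congˡ b G-q≋[]) (*ₚ-zeroʳ b))
    where
    G-q≋[] : G -ₚ q ≋ []
    G-q≋[] = *ₚ-monic-degreeBelow⇒≋[] m (G -ₚ q) λ i d≤i → trans (sym (coeff-≡ r≋b[G-q] i)) (low i d≤i)

monic-∣-constₚ*ₚ : ∀ {h g c} → Monic h → c ≢ + 0 → h ∣ₚ constₚ c *ₚ g → h ∣ₚ g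
monic-∣-constₚ*ₚ {h} {g} {c} m c≢0 (s , sh≋cg) with divMonic-division m g
... | r , g≋qh+r , low = q , ≋-sym (≋-trans g≋qh+r (≋-trans (+ₚ-cong ≋-refl r≋[]) (+ₚ-identityʳ (q *ₚ h))))
  where
  q = divMonic g h
  ĉ = constₚ c
  cr≋h[s-cq] : ĉ *ₚ r ≋ h *ₚ (s -ₚ ĉ *ₚ q)
  cr≋h[s-cq] = ≋-trans (isolate h q r ĉ) (≋-trans (-ₚ-cong (*ₚ-congˡ ĉ (≋-sym g≋qh+r)) ≋-refl)
                        (≋-trans (-ₚ-cong (≋-sym sh≋cg) ≋-refl) (factor h s q ĉ)))
    where
    isolate : ∀ h q r ĉ → ĉ *ₚ r ≋ ĉ *ₚ (q *ₚ h +ₚ r) -ₚ (ĉ *ₚ q) *ₚ h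
    isolate = solve-∀ ℤ[X]-acr
    factor : ∀ h s q ĉ → s *ₚ h -ₚ (ĉ *ₚ q) *ₚ h ≋ h *ₚ (s -ₚ ĉ *ₚ q)
    factor = solve-∀ ℤ[X]-acr
  coeff-cr : ∀ i → coeff (ĉ *ₚ r) i ≡ c ℤ.* coeff r i
  coeff-cr i = trans (sym (coeff-≡ (scaleₚ≋constₚ*ₚ c r) i)) (coeff-scaleₚ c r i)
  cr≋[] : ĉ *ₚ r ≋ []
  cr≋[] = ≋-trans cr≋h[s-cq] (≋-trans (*ₚ-congˡ h s-cq≋[]) (*ₚ-zeroʳ h))
    where
    s-cq≋[] : s -ₚ ĉ *ₚ q ≋ []
    s-cq≋[] = *ₚ-monic-degreeBelow⇒≋[] m (s -ₚ ĉ *ₚ q) λ i d≤i →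
      trans (sym (coeff-≡ cr≋h[s-cq] i)) (trans (coeff-cr i) (trans (cong (c ℤ.*_) (low i d≤i)) (ℤ.*-zeroʳ c)))
  r≋[] : r ≋ []
  r≋[] .coeff-≡ i = [ ⊥-elim ∘ c≢0 , id ]′ (ℤ.i*j≡0⇒i≡0∨j≡0 c (trans (sym (coeff-cr i)) (coeff-≡ cr≋[] i)))

divMonic-unfold-monic : ∀ ys xs → divMonic (ys ++ + 1 ∷ []) (xs ++ + 1 ∷ [])
                                  ≡ reverse (divLoop (reverse xs) (suc (length ys)) (+ 1 ∷ reverse ys))
divMonic-unfold-monic ys xs = trans (divMonic-unfold (ys ++ + 1 ∷ []) xs)
  (cong₂ (λ f g → reverse (divLoop (reverse xs) f g))
         (trans (length-++ ys) (ℕ.+-comm (length ys) 1)) (reverse-++ ys (+ 1 ∷ [])))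

divMonic-monic : ∀ {a b} → Monic a → Monic b → b ∣ₚ a → Monic (divMonic a b)
divMonic-monic {a} {b} (monic ys) (monic xs) b∣a with divLoop-leading-one (reverse xs) (length ys) (reverse ys)
... | inj₁ empty = ⊥-elim (+1≢+0 (begin
  + 1                                       ≡⟨ monic-leading (monic ys) ⟨
  coeff a (length ys)                       ≡⟨ coeff-≡ (divMonic-exact (monic xs) b∣a) (length ys) ⟨
  coeff (divMonic a b *ₚ b) (length ys)     ≡⟨ cong (λ z → coeff (z *ₚ b) (length ys))
                                                   (trans (divMonic-unfold-monic ys xs) (cong reverse empty)) ⟩
  + 0                                       ∎))
  where
  open ≡-Reasoning
  +1≢+0 : + 1 ≢ + 0
  +1≢+0 ()
... | inj₂ (Q , leading) =
  subst Monic (sym (trans (divMonic-unfold-monic ys xs) (trans (cong reverse leading) (unfold-reverse (+ 1) Q))))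
                                 (monic (reverse Q))

-- Finite sums

Σ< : ℕ → (ℕ → Poly) → Poly
Σ< zero    f = []
Σ< (suc m) f = Σ< m f +ₚ f m

Σ<-cong : ∀ m {f g} → (∀ a → a ℕ.< m → f a ≋ g a) → Σ< m f ≋ Σ< m g
Σ<-cong zero    f≋g = ≋-refl
Σ<-cong (suc m) f≋g = +ₚ-cong (Σ<-cong m λ a a<m → f≋g a (ℕ.m≤n⇒m≤1+n a<m)) (f≋g m ℕ.≤-refl)

Σ<-zero : ∀ m {f} → (∀ a → a ℕ.< m → f a ≋ []) → Σ< m f ≋ []
Σ<-zero zero    f≋[] = ≋-refl
Σ<-zero (suc m) f≋[] = +ₚ-cong (Σ<-zero m λ a a<m → f≋[] a (ℕ.m≤n⇒m≤1+n a<m)) (f≋[] m ℕ.≤-refl)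

Σ<-+ : ∀ m f g → Σ< m (λ a → f a +ₚ g a) ≋ Σ< m f +ₚ Σ< m g
Σ<-+ zero    f g = ≋-refl
Σ<-+ (suc m) f g = ≋-trans (+ₚ-cong (Σ<-+ m f g) ≋-refl) (+ₚ-interchange (Σ< m f) (Σ< m g) (f m) (g m))

Σ<-negₚ : ∀ m f → Σ< m (negₚ ∘ f) ≋ negₚ (Σ< m f)
Σ<-negₚ zero    f = ≋-refl
Σ<-negₚ (suc m) f = ≋-trans (+ₚ-cong (Σ<-negₚ m f) ≋-refl) (≋-sym (scaleₚ-distribˡ (ℤ.- + 1) (Σ< m f) (f m)))

Σ<-swap : ∀ m n (F : ℕ → ℕ → Poly) → Σ< m (λ a → Σ< n (F a)) ≋ Σ< n (λ e → Σ< m (λ a → F a e))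
Σ<-swap zero    n F = ≋-sym (Σ<-zero n λ _ _ → ≋-refl)
Σ<-swap (suc m) n F = ≋-trans (+ₚ-cong (Σ<-swap m n F) ≋-refl) (≋-sym (Σ<-+ n (λ e → Σ< m (λ a → F a e)) (F m)))

Σ<-shift : ∀ m f → Σ< (suc m) f ≋ f 0 +ₚ Σ< m (f ∘ suc)
Σ<-shift zero    f = +ₚ-comm [] (f 0)
Σ<-shift (suc m) f = ≋-trans (+ₚ-cong (Σ<-shift m f) ≋-refl) (+ₚ-assoc (f 0) (Σ< m (f ∘ suc)) (f (suc m)))

Σ<-++ : ∀ m n f → Σ< (m ℕ.+ n) f ≋ Σ< m f +ₚ Σ< n (λ r → f (m ℕ.+ r))
Σ<-++ m zero    f rewrite ℕ.+-identityʳ m = ≋-sym (+ₚ-identityʳ (Σ< m f))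
Σ<-++ m (suc n) f rewrite ℕ.+-suc m n =
  ≋-trans (+ₚ-cong (Σ<-++ m n f) ≋-refl) (+ₚ-assoc (Σ< m f) (Σ< n (λ r → f (m ℕ.+ r))) (f (m ℕ.+ n)))

Σ<-blocks : ∀ k e f → Σ< (k ℕ.* e) f ≋ Σ< k (λ b → Σ< e (λ r → f (b ℕ.* e ℕ.+ r)))
Σ<-blocks zero    e f = ≋-refl
Σ<-blocks (suc k) e f rewrite ℕ.+-comm e (k ℕ.* e) =
  ≋-trans (Σ<-++ (k ℕ.* e) e f) (+ₚ-cong (Σ<-blocks k e f) ≋-refl)

Σ<-reverse : ∀ m f → Σ< m f ≋ Σ< m (λ a → f (m ∸ suc a))
Σ<-reverse zero    f = ≋-refl
Σ<-reverse (suc m) f = ≋-trans (+ₚ-comm (Σ< m f) (f m))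
  (≋-trans (+ₚ-cong ≋-refl (Σ<-reverse m f)) (≋-sym (Σ<-shift m (λ a → f (suc m ∸ suc a)))))

Σ<-reflect : ∀ m g → g 0 ≋ g m → Σ< m (λ a → g (m ∸ a)) ≋ Σ< m g
Σ<-reflect m g g0≋gm = begin
  Σ< m (λ a → g (m ∸ a))                    ≈⟨ Σ<-reverse m (λ a → g (m ∸ a)) ⟩
  Σ< m (λ a → g (m ∸ (m ∸ suc a)))          ≈⟨ Σ<-cong m (λ a a<m → ≡⇒≋ (cong g (ℕ.m∸[m∸n]≡n a<m))) ⟩
  Σ< m (g ∘ suc)                            ≈⟨ cancel (g 0) (Σ< m (g ∘ suc)) ⟩
  (g 0 +ₚ Σ< m (g ∘ suc)) -ₚ g 0            ≈⟨ -ₚ-cong (Σ<-shift m g) (≋-sym g0≋gm) ⟨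
  (Σ< m g +ₚ g m) -ₚ g m                    ≈⟨ cancel′ (Σ< m g) (g m) ⟩
  Σ< m g                                    ∎
  where
  open ≋-Reasoning
  cancel : ∀ x s → s ≋ (x +ₚ s) -ₚ x
  cancel = solve-∀ ℤ[X]-acr
  cancel′ : ∀ s x → (s +ₚ x) -ₚ x ≋ s
  cancel′ = solve-∀ ℤ[X]-acr

if-yes : ∀ {P : Set} (P? : Dec P) v → P → (if does P? then v else []) ≋ v
if-yes (yes _) v _ = ≋-refl
if-yes (no ¬p) v p = ⊥-elim (¬p p)

if-no : ∀ {P : Set} (P? : Dec P) v → ¬ P → (if does P? then v else []) ≋ []
if-no (yes p) v ¬p = ⊥-elim (¬p p)
if-no (no _)  v _  = ≋-refl

if-⇔ : ∀ {P Q : Set} (P? : Dec P) (Q? : Dec Q) {u v} → (P → Q) → (Q → P) → u ≋ v →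
       (if does P? then u else []) ≋ (if does Q? then v else [])
if-⇔ (yes p) (yes q) P⇒Q Q⇒P u≋v = u≋v
if-⇔ (yes p) (no ¬q) P⇒Q Q⇒P u≋v = ⊥-elim (¬q (P⇒Q p))
if-⇔ (no ¬p) (yes q) P⇒Q Q⇒P u≋v = ⊥-elim (¬p (Q⇒P q))
if-⇔ (no ¬p) (no ¬q) P⇒Q Q⇒P u≋v = ≋-refl

if-negₚ-+ₚ : ∀ b u v → (if b then negₚ (u +ₚ v) else []) ≋ negₚ ((if b then u else []) +ₚ (if b then v else []))
if-negₚ-+ₚ true  u v = ≋-refl
if-negₚ-+ₚ false u v = ≋-refl

Σ<-single : ∀ K {c} (F : ℕ → Poly) → c ℕ.< K → Σ< K (λ e → if does (c ℕ.≟ e) then F e else []) ≋ F c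
Σ<-single (suc K) {c} F c<1+K with c ℕ.≟ K
... | yes refl = ≋-trans (+ₚ-cong (Σ<-zero c λ e e<c → if-no (c ℕ.≟ e) (F e) λ c≡e → ℕ.<-irrefl (sym c≡e) e<c)
                                  (if-yes (c ℕ.≟ c) (F c) refl))
                         (+ₚ-identityˡ (F c))
... | no  c≢K  = ≋-trans (+ₚ-cong ≋-refl (if-no (c ℕ.≟ K) (F K) c≢K))
                         (≋-trans (+ₚ-identityʳ _) (Σ<-single K F (ℕ.≤∧≢⇒< (ℕ.≤-pred c<1+K) c≢K)))

Σ<-partition : ∀ m K (g : ℕ → ℕ) f → (∀ a → a ℕ.< m → g a ℕ.< K) →
               Σ< m f ≋ Σ< K (λ e → Σ< m (λ a → if does (g a ℕ.≟ e) then f a else []))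
Σ<-partition m K g f g<K = ≋-trans (Σ<-cong m λ a a<m → ≋-sym (Σ<-single K (λ _ → f a) (g<K a a<m)))
                                   (Σ<-swap m K (λ a e → if does (g a ℕ.≟ e) then f a else []))

Σ<-pull : ∀ K {c} (F : ℕ → Poly) → c ℕ.< K → Σ< K F ≋ F c +ₚ Σ< K (λ e → if does (c ℕ.≟ e) then [] else F e)
Σ<-pull K {c} F c<K = ≋-trans (Σ<-cong K λ e _ → split e)
  (≋-trans (Σ<-+ K _ _) (+ₚ-cong (Σ<-single K F c<K) ≋-refl))
  where
  split : ∀ e → F e ≋ (if does (c ℕ.≟ e) then F e else []) +ₚ (if does (c ℕ.≟ e) then [] else F e)
  split e with does (c ℕ.≟ e)
  ... | true  = ≋-sym (+ₚ-identityʳ (F e))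
  ... | false = ≋-refl

foldr-+ₚ-filter : ∀ {P : Pred ℕ 0ℓ} (P? : Decidable P) (f : ℕ → Poly) xs →
                  foldr (λ a acc → f a +ₚ acc) [] (filter P? xs)
                  ≋ foldr (λ a acc → (if does (P? a) then f a else []) +ₚ acc) [] xs
foldr-+ₚ-filter P? f []       = ≋-refl
foldr-+ₚ-filter P? f (x ∷ xs) with does (P? x)
... | true  = +ₚ-cong ≋-refl (foldr-+ₚ-filter P? f xs)
... | false = foldr-+ₚ-filter P? f xs

foldr-+ₚ-applyUpTo : ∀ (f : ℕ → Poly) g m → foldr (λ a acc → f a +ₚ acc) [] (applyUpTo g m) ≋ Σ< m (f ∘ g)
foldr-+ₚ-applyUpTo f g zero    = ≋-refl
foldr-+ₚ-applyUpTo f g (suc m) = ≋-trans (+ₚ-cong ≋-refl (foldr-+ₚ-applyUpTo f (g ∘ suc) m)) (≋-sym (Σ<-shift m (f ∘ g)))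

foldr-+ₚ-filter-upTo : ∀ {P : Pred ℕ 0ℓ} (P? : Decidable P) (f : ℕ → Poly) m →
                       foldr (λ a acc → f a +ₚ acc) [] (filter P? (upTo m)) ≋ Σ< m (λ a → if does (P? a) then f a else [])
foldr-+ₚ-filter-upTo P? f m =
  ≋-trans (foldr-+ₚ-filter P? f (upTo m)) (foldr-+ₚ-applyUpTo (λ a → if does (P? a) then f a else []) id m)

Σ<-cong-mod : ∀ {h} m {f g} → (∀ a → a ℕ.< m → f a ≈ g a mod h) → Σ< m f ≈ Σ< m g mod h
Σ<-cong-mod zero    f≈g = ≈mod-refl
Σ<-cong-mod (suc m) f≈g = +ₚ-cong-mod (Σ<-cong-mod m λ a a<m → f≈g a (ℕ.m≤n⇒m≤1+n a<m)) (f≈g m ℕ.≤-refl)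

if-cong-mod : ∀ {h} {P : Set} (P? : Dec P) {u v} → (P → u ≈ v mod h) →
              (if does P? then u else []) ≈ (if does P? then v else []) mod h
if-cong-mod (yes p) u≈v = u≈v p
if-cong-mod (no  _) u≈v = ≈mod-refl

ConstantMod-Σ< : ∀ {h} m {f} → (∀ a → a ℕ.< m → ConstantMod h (f a)) → ConstantMod h (Σ< m f)
ConstantMod-Σ< zero    const = ConstantMod-zero ≋-refl
ConstantMod-Σ< (suc m) const = ConstantMod-+ₚ (ConstantMod-Σ< m λ a a<m → const a (ℕ.m≤n⇒m≤1+n a<m)) (const m ℕ.≤-refl)

-- Geometric sums and X^N - 1

geometric : ℕ → ℕ → Poly
geometric g k = Σ< k (λ j → monoₚ (j ℕ.* g))

XN-1-*ₚ-geometric : ∀ g k → XN-1 g *ₚ geometric g k ≋ XN-1 (k ℕ.* g)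
XN-1-*ₚ-geometric g zero    = ≋-trans (*ₚ-zeroʳ (XN-1 g)) (≋-sym (+ₚ-inverseʳ (constₚ (+ 1))))
XN-1-*ₚ-geometric g (suc k) = begin
  XN-1 g *ₚ (geometric g k +ₚ Xᵏᵍ)           ≈⟨ *ₚ-distribˡ (XN-1 g) (geometric g k) Xᵏᵍ ⟩
  XN-1 g *ₚ geometric g k +ₚ XN-1 g *ₚ Xᵏᵍ   ≈⟨ +ₚ-cong (XN-1-*ₚ-geometric g k) ≋-refl ⟩
  XN-1 (k ℕ.* g) +ₚ XN-1 g *ₚ Xᵏᵍ            ≈⟨ telescope (monoₚ g) Xᵏᵍ ⟩
  monoₚ g *ₚ Xᵏᵍ -ₚ constₚ (+ 1)             ≈⟨ -ₚ-cong (monoₚ-+ g (k ℕ.* g)) ≋-refl ⟨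
  XN-1 (g ℕ.+ k ℕ.* g)                       ∎
  where
  open ≋-Reasoning
  Xᵏᵍ = monoₚ (k ℕ.* g)
  telescope : ∀ Xᵍ Xᵏᵍ → (Xᵏᵍ -ₚ constₚ (+ 1)) +ₚ (Xᵍ -ₚ constₚ (+ 1)) *ₚ Xᵏᵍ ≋ Xᵍ *ₚ Xᵏᵍ -ₚ constₚ (+ 1)
  telescope = solve-∀ ℤ[X]-acr

XN-1-∣ : ∀ {g N} → g ∣ N → XN-1 g ∣ₚ XN-1 N
XN-1-∣ {g} (divides k refl) = geometric g k , ≋-trans (*ₚ-comm (geometric g k) (XN-1 g)) (XN-1-*ₚ-geometric g k)

module _ {g : ℕ} where
  open ≈mod-Reasoning (XN-1 g)

  monoₚ-multiple≈1 : ∀ j → monoₚ (j ℕ.* g) ≈ constₚ (+ 1) mod XN-1 g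
  monoₚ-multiple≈1 zero    = ≈mod-refl
  monoₚ-multiple≈1 (suc j) = begin
    monoₚ (g ℕ.+ j ℕ.* g)                  ≈⟨ ≋⇒≈mod (monoₚ-+ g (j ℕ.* g)) ⟩
    monoₚ g *ₚ monoₚ (j ℕ.* g)             ≈⟨ *ₚ-cong-mod (divides-difference ∣ʳ-refl) (monoₚ-multiple≈1 j) ⟩
    constₚ (+ 1) *ₚ constₚ (+ 1)           ≈⟨ ≋⇒≈mod (*ₚ-identityˡ (constₚ (+ 1))) ⟩
    constₚ (+ 1)                           ∎

  monoₚ-+-multiple : ∀ e j → monoₚ (e ℕ.+ j ℕ.* g) ≈ monoₚ e mod XN-1 g
  monoₚ-+-multiple e j = begin
    monoₚ (e ℕ.+ j ℕ.* g)                  ≈⟨ ≋⇒≈mod (monoₚ-+ e (j ℕ.* g)) ⟩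
    monoₚ e *ₚ monoₚ (j ℕ.* g)             ≈⟨ *ₚ-cong-mod (≈mod-refl {p = monoₚ e}) (monoₚ-multiple≈1 j) ⟩
    monoₚ e *ₚ constₚ (+ 1)                ≈⟨ ≋⇒≈mod (*ₚ-identityʳ (monoₚ e)) ⟩
    monoₚ e                                ∎

  geometric≈length : ∀ k → geometric g k ≈ constₚ (+ k) mod XN-1 g
  geometric≈length zero    = ≋⇒≈mod (≋-sym constₚ-zero)
  geometric≈length (suc k) = begin
    geometric g k +ₚ monoₚ (k ℕ.* g)       ≈⟨ +ₚ-cong-mod (geometric≈length k) (monoₚ-multiple≈1 k) ⟩
    constₚ (+ (k ℕ.+ 1))                   ≡⟨ cong (λ n → constₚ (+ n)) (ℕ.+-comm k 1) ⟩
    constₚ (+ suc k)                       ∎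

monoₚ-cong : ∀ {L e₁ e₂} j₁ j₂ → e₁ ℕ.+ j₁ ℕ.* L ≡ e₂ ℕ.+ j₂ ℕ.* L → monoₚ e₁ ≈ monoₚ e₂ mod XN-1 L
monoₚ-cong {L} {e₁} {e₂} j₁ j₂ eq =
  ≈mod-trans (≈mod-sym (monoₚ-+-multiple e₁ j₁))
             (≈mod-trans (≋⇒≈mod (≡⇒≋ (cong monoₚ eq))) (monoₚ-+-multiple e₂ j₂))

XN-1-combination : ∀ {d a b} x y → d ℕ.+ y ℕ.* b ≡ x ℕ.* a →
                   XN-1 d ≋ geometric a x *ₚ XN-1 a +ₚ negₚ (monoₚ d *ₚ geometric b y) *ₚ XN-1 b
XN-1-combination {d} {a} {b} x y d+yb≡xa = begin
  XN-1 d                                                   ≈⟨ split (monoₚ d) (monoₚ (y ℕ.* b)) ⟩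
  (Xᵈ *ₚ monoₚ (y ℕ.* b) -ₚ one) -ₚ Xᵈ *ₚ XN-1 (y ℕ.* b)  ≈⟨ -ₚ-cong (-ₚ-cong (monoₚ-+ d (y ℕ.* b)) ≋-refl) ≋-refl ⟨
  XN-1 (d ℕ.+ y ℕ.* b) -ₚ Xᵈ *ₚ XN-1 (y ℕ.* b)             ≡⟨ cong (λ n → XN-1 n -ₚ Xᵈ *ₚ XN-1 (y ℕ.* b)) d+yb≡xa ⟩
  XN-1 (x ℕ.* a) -ₚ Xᵈ *ₚ XN-1 (y ℕ.* b)                   ≈⟨ -ₚ-cong (XN-1-*ₚ-geometric a x) (*ₚ-congˡ Xᵈ (XN-1-*ₚ-geometric b y)) ⟨
  XN-1 a *ₚ geometric a x -ₚ Xᵈ *ₚ (XN-1 b *ₚ geometric b y) ≈⟨ regroup (XN-1 a) (geometric a x) Xᵈ (XN-1 b) (geometric b y) ⟩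
  geometric a x *ₚ XN-1 a +ₚ negₚ (Xᵈ *ₚ geometric b y) *ₚ XN-1 b ∎
  where
  open ≋-Reasoning
  Xᵈ = monoₚ d
  one = constₚ (+ 1)
  split : ∀ Xᵈ Y → Xᵈ -ₚ constₚ (+ 1) ≋ (Xᵈ *ₚ Y -ₚ constₚ (+ 1)) -ₚ Xᵈ *ₚ (Y -ₚ constₚ (+ 1))
  split = solve-∀ ℤ[X]-acr
  regroup : ∀ Xa Ga Xᵈ Xb Gb → Xa *ₚ Ga -ₚ Xᵈ *ₚ (Xb *ₚ Gb) ≋ Ga *ₚ Xa +ₚ negₚ (Xᵈ *ₚ Gb) *ₚ Xb
  regroup = solve-∀ ℤ[X]-acr

XN-1-gcd : ∀ a b → ∃₂ λ A B → XN-1 (gcd a b) ≋ A *ₚ XN-1 a +ₚ B *ₚ XN-1 b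
XN-1-gcd a b with Bézout.identity (gcd-GCD a b)
... | Bézout.+- x y g+yb≡xa = geometric a x , negₚ (monoₚ (gcd a b) *ₚ geometric b y) , XN-1-combination x y g+yb≡xa
... | Bézout.-+ x y g+xa≡yb = negₚ (monoₚ (gcd a b) *ₚ geometric a x) , geometric b y , ≋-trans (XN-1-combination y x g+xa≡yb)
    (+ₚ-comm (geometric b y *ₚ XN-1 b) (negₚ (monoₚ (gcd a b) *ₚ geometric a x) *ₚ XN-1 a))

-- Coprimality over ℚ

record Coprimeℚ (u v : Poly) : Set where
  constructor bezout
  field
    A B      : Poly
    c        : ℤ
    c≢0      : c ≢ + 0
    identity : A *ₚ u +ₚ B *ₚ v ≋ constₚ c

Coprimeℚ-sym : ∀ {u v} → Coprimeℚ u v → Coprimeℚ v u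
Coprimeℚ-sym {u} {v} (bezout A B c c≢0 eq) = bezout B A c c≢0 (≋-trans (+ₚ-comm (B *ₚ v) (A *ₚ u)) eq)

Coprimeℚ-oneʳ : ∀ u → Coprimeℚ u (constₚ (+ 1))
Coprimeℚ-oneʳ u = bezout [] (constₚ (+ 1)) (+ 1) (λ ()) (*ₚ-identityˡ (constₚ (+ 1)))

Coprimeℚ-*ₚʳ : ∀ {u v w} → Coprimeℚ u v → Coprimeℚ u w → Coprimeℚ u (v *ₚ w)
Coprimeℚ-*ₚʳ {u} {v} {w} (bezout A₁ B₁ c₁ c₁≢0 eq₁) (bezout A₂ B₂ c₂ c₂≢0 eq₂) =
  bezout (A₁ *ₚ A₂ *ₚ u +ₚ A₁ *ₚ B₂ *ₚ w +ₚ B₁ *ₚ v *ₚ A₂) (B₁ *ₚ B₂) (c₁ ℤ.* c₂) c₁c₂≢0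
    (≋-trans (≋-sym (expand A₁ u B₁ v A₂ B₂ w)) (≋-trans (*ₚ-cong eq₁ eq₂) (≋-sym (constₚ-* c₁ c₂))))
  where
  expand : ∀ A₁ u B₁ v A₂ B₂ w → (A₁ *ₚ u +ₚ B₁ *ₚ v) *ₚ (A₂ *ₚ u +ₚ B₂ *ₚ w)
           ≋ (A₁ *ₚ A₂ *ₚ u +ₚ A₁ *ₚ B₂ *ₚ w +ₚ B₁ *ₚ v *ₚ A₂) *ₚ u +ₚ (B₁ *ₚ B₂) *ₚ (v *ₚ w)
  expand = solve-∀ ℤ[X]-acr
  c₁c₂≢0 : c₁ ℤ.* c₂ ≢ + 0
  c₁c₂≢0 eq with ℤ.i*j≡0⇒i≡0∨j≡0 c₁ eq
  ... | inj₁ c₁≡0 = c₁≢0 c₁≡0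
  ... | inj₂ c₂≡0 = c₂≢0 c₂≡0

Coprimeℚ-combination : ∀ {u w p q A′ B′} → Coprimeℚ u w → w ≋ A′ *ₚ p +ₚ B′ *ₚ q → u ∣ₚ p → Coprimeℚ u q
Coprimeℚ-combination {u} {w} {p} {q} {A′} {B′} (bezout A B c c≢0 eq) w≋ (P , Pu≋p) =
  bezout (A +ₚ B *ₚ A′ *ₚ P) (B *ₚ B′) c c≢0 (begin
    (A +ₚ B *ₚ A′ *ₚ P) *ₚ u +ₚ (B *ₚ B′) *ₚ q    ≈⟨ regroup A B A′ P u B′ q ⟩
    A *ₚ u +ₚ B *ₚ (A′ *ₚ (P *ₚ u) +ₚ B′ *ₚ q)   ≈⟨ +ₚ-cong ≋-refl (*ₚ-congˡ B (+ₚ-cong (*ₚ-congˡ A′ Pu≋p) ≋-refl)) ⟩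
    A *ₚ u +ₚ B *ₚ (A′ *ₚ p +ₚ B′ *ₚ q)          ≈⟨ +ₚ-cong ≋-refl (*ₚ-congˡ B w≋) ⟨
    A *ₚ u +ₚ B *ₚ w                              ≈⟨ eq ⟩
    constₚ c                                      ∎)
  where
  open ≋-Reasoning
  regroup : ∀ A B A′ P u B′ q → (A +ₚ B *ₚ A′ *ₚ P) *ₚ u +ₚ (B *ₚ B′) *ₚ q
                               ≋ A *ₚ u +ₚ B *ₚ (A′ *ₚ (P *ₚ u) +ₚ B′ *ₚ q)
  regroup = solve-∀ ℤ[X]-acr

Coprimeℚ-∣ʳ : ∀ {u v w} → Coprimeℚ u v → w ∣ₚ v → Coprimeℚ u w
Coprimeℚ-∣ʳ {u} {v} {w} cop (Q , Qw≋v) =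
  Coprimeℚ-combination {A′ = []} {B′ = Q} cop (≋-sym (≋-trans (+ₚ-identityˡ (Q *ₚ w)) Qw≋v)) (u ∣0)

Coprimeℚ-∣ˡ : ∀ {u v w} → Coprimeℚ u v → w ∣ₚ u → Coprimeℚ w v
Coprimeℚ-∣ˡ cop w∣u = Coprimeℚ-sym (Coprimeℚ-∣ʳ (Coprimeℚ-sym cop) w∣u)

monic-coprime-∣ : ∀ {u v g} → Monic u → Coprimeℚ u v → u ∣ₚ v *ₚ g → u ∣ₚ g
monic-coprime-∣ {u} {v} {g} mu (bezout A B c c≢0 eq) (Q , Qu≋vg) = monic-∣-constₚ*ₚ mu c≢0
  (A *ₚ g +ₚ B *ₚ Q , (begin
    (A *ₚ g +ₚ B *ₚ Q) *ₚ u        ≈⟨ regroup A g B Q u ⟩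
    (A *ₚ u) *ₚ g +ₚ B *ₚ (Q *ₚ u) ≈⟨ +ₚ-cong ≋-refl (*ₚ-congˡ B Qu≋vg) ⟩
    (A *ₚ u) *ₚ g +ₚ B *ₚ (v *ₚ g) ≈⟨ regroup′ A u B v g ⟩
    (A *ₚ u +ₚ B *ₚ v) *ₚ g        ≈⟨ *ₚ-congʳ g eq ⟩
    constₚ c *ₚ g                  ∎))
  where
  open ≋-Reasoning
  regroup : ∀ A g B Q u → (A *ₚ g +ₚ B *ₚ Q) *ₚ u ≋ (A *ₚ u) *ₚ g +ₚ B *ₚ (Q *ₚ u)
  regroup = solve-∀ ℤ[X]-acr
  regroup′ : ∀ A u B v g → (A *ₚ u) *ₚ g +ₚ B *ₚ (v *ₚ g) ≋ (A *ₚ u +ₚ B *ₚ v) *ₚ g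
  regroup′ = solve-∀ ℤ[X]-acr

monic-coprime-*ₚ-∣ : ∀ {u v g} → Monic (u *ₚ v) → Coprimeℚ u v → u ∣ₚ g → v ∣ₚ g → u *ₚ v ∣ₚ g
monic-coprime-*ₚ-∣ {u} {v} {g} muv (bezout A B c c≢0 eq) (P , Pu≋g) (Q , Qv≋g) = monic-∣-constₚ*ₚ muv c≢0
  (A *ₚ Q +ₚ B *ₚ P , (begin
    (A *ₚ Q +ₚ B *ₚ P) *ₚ (u *ₚ v)            ≈⟨ regroup A Q B P u v ⟩
    (A *ₚ u) *ₚ (Q *ₚ v) +ₚ (B *ₚ v) *ₚ (P *ₚ u) ≈⟨ +ₚ-cong (*ₚ-congˡ (A *ₚ u) Qv≋g) (*ₚ-congˡ (B *ₚ v) Pu≋g) ⟩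
    (A *ₚ u) *ₚ g +ₚ (B *ₚ v) *ₚ g            ≈⟨ *ₚ-distribʳ g (A *ₚ u) (B *ₚ v) ⟨
    (A *ₚ u +ₚ B *ₚ v) *ₚ g                   ≈⟨ *ₚ-congʳ g eq ⟩
    constₚ c *ₚ g                             ∎))
  where
  open ≋-Reasoning
  regroup : ∀ A Q B P u v → (A *ₚ Q +ₚ B *ₚ P) *ₚ (u *ₚ v)
                           ≋ (A *ₚ u) *ₚ (Q *ₚ v) +ₚ (B *ₚ v) *ₚ (P *ₚ u)
  regroup = solve-∀ ℤ[X]-acr

-- Cyclotomic factorisation

prodDiv-++ : ∀ N xs ys → prodDiv N (xs ++ ys) ≋ prodDiv N xs *ₚ prodDiv N ys
prodDiv-++ N []             ys = ≋-sym (*ₚ-identityˡ (prodDiv N ys))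
prodDiv-++ N ((d , φ) ∷ xs) ys with d ∣? N
... | yes _ = ≋-trans (*ₚ-congˡ φ (prodDiv-++ N xs ys)) (≋-sym (*ₚ-assoc φ (prodDiv N xs) (prodDiv N ys)))
... | no  _ = prodDiv-++ N xs ys

prodDiv-single-∣ : ∀ {N d} φ → d ∣ N → prodDiv N ((d , φ) ∷ []) ≋ φ
prodDiv-single-∣ {N} {d} φ d∣N with d ∣? N
... | yes _   = *ₚ-identityʳ φ
... | no  d∤N = ⊥-elim (d∤N d∣N)

prodDiv-single-∤ : ∀ {N d} φ → ¬ d ∣ N → prodDiv N ((d , φ) ∷ []) ≋ constₚ (+ 1)
prodDiv-single-∤ {N} {d} φ d∤N with d ∣? N
... | yes d∣N = ⊥-elim (d∤N d∣N)
... | no  _   = ≋-refl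

∏Φ : ℕ → ℕ → Poly
∏Φ N n = prodDiv N (cycTable n)

∏Φ-suc-∣ : ∀ {N n} → suc n ∣ N → ∏Φ N (suc n) ≋ ∏Φ N n *ₚ Φ (suc n)
∏Φ-suc-∣ {N} {n} d∣N =
  ≋-trans (prodDiv-++ N (cycTable n) _) (*ₚ-congˡ (∏Φ N n) (prodDiv-single-∣ (Φ (suc n)) d∣N))

∏Φ-suc-∤ : ∀ {N n} → ¬ suc n ∣ N → ∏Φ N (suc n) ≋ ∏Φ N n
∏Φ-suc-∤ {N} {n} d∤N = ≋-trans (prodDiv-++ N (cycTable n) _)
  (≋-trans (*ₚ-congˡ (∏Φ N n) (prodDiv-single-∤ (Φ (suc n)) d∤N)) (*ₚ-identityʳ (∏Φ N n)))

∏Φ-∣-∏Φ-suc : ∀ N n → ∏Φ N n ∣ₚ ∏Φ N (suc n)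
∏Φ-∣-∏Φ-suc N n with suc n ∣? N
... | yes d∣N = ∣ʳ-respʳ-≈ (≋-sym (∏Φ-suc-∣ d∣N)) (∣ₚ-*ₚʳ (Φ (suc n)) ∣ʳ-refl)
... | no  d∤N = ∣ʳ-reflexive (≋-sym (∏Φ-suc-∤ d∤N))

∏Φ-monotone : ∀ N {n m} → n ℕ.≤ m → ∏Φ N n ∣ₚ ∏Φ N m
∏Φ-monotone N {n} {m} n≤m = subst (λ m → ∏Φ N n ∣ₚ ∏Φ N m) (ℕ.m∸n+n≡m n≤m) (go (m ∸ n))
  where
  go : ∀ k → ∏Φ N n ∣ₚ ∏Φ N (k ℕ.+ n)
  go zero    = ∣ʳ-refl
  go (suc k) = ∣ʳ-trans (go k) (∏Φ-∣-∏Φ-suc N (k ℕ.+ n))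

∏Φ-∣ : ∀ {e N} n → e ∣ N → ∏Φ e n ∣ₚ ∏Φ N n
∏Φ-∣     zero    e∣N = ∣ʳ-refl
∏Φ-∣ {e} {N} (suc n) e∣N with suc n ∣? e
... | yes d∣e = ∣ʳ-respˡ-≈ (≋-sym (∏Φ-suc-∣ d∣e)) (∣ʳ-respʳ-≈ (≋-sym (∏Φ-suc-∣ (ℕ.∣-trans d∣e e∣N)))
                  (∙-cong-∣ (∏Φ-∣ n e∣N) ∣ʳ-refl))
... | no  d∤e = ∣ʳ-respˡ-≈ (≋-sym (∏Φ-suc-∤ d∤e)) (∣ʳ-trans (∏Φ-∣ n e∣N) (∏Φ-∣-∏Φ-suc N n))

Monic-prodDiv : ∀ N xs → All (λ (d , φ) → d ∣ N → Monic φ) xs → Monic (prodDiv N xs)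
Monic-prodDiv N []             []                = monic []
Monic-prodDiv N ((d , φ) ∷ xs) (monic-φ ∷ monics) with d ∣? N
... | yes d∣N = Monic-*ₚ (monic-φ d∣N) (Monic-prodDiv N xs monics)
... | no  _   = Monic-prodDiv N xs monics

All-cycTable : ∀ {P : Σ ℕ (λ _ → Poly) → Set} n →
               (∀ {d} → 0 ℕ.< d → d ℕ.≤ n → P (d , Φ d)) → All P (cycTable n)
All-cycTable zero    p = []
All-cycTable (suc n) p =
  All.++⁺ (All-cycTable n λ 0<d d≤n → p 0<d (ℕ.m≤n⇒m≤1+n d≤n)) (p (s≤s z≤n) ℕ.≤-refl ∷ [])

Monic-∏Φ : ∀ N n → (∀ {d} → 0 ℕ.< d → d ℕ.≤ n → d ∣ N → Monic (Φ d)) → Monic (∏Φ N n)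
Monic-∏Φ N n monic-Φ = Monic-prodDiv N (cycTable n) (All-cycTable n monic-Φ)

Coprimeℚ-∏Φ : ∀ {N v} n → (∀ {d} → 0 ℕ.< d → d ℕ.≤ n → d ∣ N → Coprimeℚ (Φ d) v) → Coprimeℚ (∏Φ N n) v
Coprimeℚ-∏Φ         zero    cop = Coprimeℚ-sym (Coprimeℚ-oneʳ _)
Coprimeℚ-∏Φ {N} {v} (suc n) cop with suc n ∣? N
... | yes d∣N = Coprimeℚ-∣ˡ (Coprimeℚ-sym (Coprimeℚ-*ₚʳ (Coprimeℚ-sym (Coprimeℚ-∏Φ n cop′))
                                                        (Coprimeℚ-sym (cop (s≤s z≤n) ℕ.≤-refl d∣N))))
                            (∣ʳ-reflexive (∏Φ-suc-∣ d∣N))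
  where cop′ = λ {d} 0<d d≤n → cop {d} 0<d (ℕ.m≤n⇒m≤1+n d≤n)
... | no  d∤N = Coprimeℚ-∣ˡ (Coprimeℚ-∏Φ n λ 0<d d≤n → cop 0<d (ℕ.m≤n⇒m≤1+n d≤n))
                            (∣ʳ-reflexive (∏Φ-suc-∤ d∤N))

record CyclotomicFactorisation (N : ℕ) : Set where
  field
    Φ-monic : Monic (Φ N)
    XN-1≋∏Φ : XN-1 N ≋ ∏Φ N N
open CyclotomicFactorisation

XN-1≋proper*Φ : ∀ {n} → CyclotomicFactorisation (suc n) → XN-1 (suc n) ≋ ∏Φ (suc n) n *ₚ Φ (suc n)
XN-1≋proper*Φ {n} cf = ≋-trans (XN-1≋∏Φ cf) (∏Φ-suc-∣ {n = n} ℕ.∣-refl)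

factorisation⇒Φ∣XN-1 : ∀ {N} → CyclotomicFactorisation N → Φ N ∣ₚ XN-1 N
factorisation⇒Φ∣XN-1 {zero}  cf with () ← monic-leading (Φ-monic cf)
factorisation⇒Φ∣XN-1 {suc n} cf = ∣ʳ-respʳ-≈ (≋-sym (XN-1≋proper*Φ {n} cf)) (x∣ʳyx (Φ (suc n)) (∏Φ (suc n) n))

0<gcd : ∀ {d} e → 0 ℕ.< d → 0 ℕ.< gcd d e
0<gcd {d} e 0<d = ℕ.n≢0⇒n>0 (gcd[m,n]≢0 d e (inj₁ (ℕ.n>0⇒n≢0 0<d)))

gcd≤ : ∀ {d} e → 0 ℕ.< d → gcd d e ℕ.≤ d
gcd≤ {d} e 0<d = ∣⇒≤ {{ℕ.>-nonZero 0<d}} (gcd[m,n]∣m d e)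

Φ-coprime-XN-1-divisor : ∀ {d g} → CyclotomicFactorisation d → CyclotomicFactorisation g →
                         g ∣ d → g ℕ.< d → 0 ℕ.< g → Coprimeℚ (Φ d) (XN-1 g)
Φ-coprime-XN-1-divisor {suc n} {suc h} cf-d cf-g (divides k d≡kg) (s≤s g≤n) _ =
  bezout H (negₚ V) (+ k) k≢0 (begin
    H *ₚ Φ d +ₚ negₚ V *ₚ Xᵍ-1              ≈⟨ regroup H (Φ d) V Xᵍ-1 ⟩
    Φ d *ₚ H -ₚ V *ₚ Xᵍ-1                   ≈⟨ -ₚ-cong ΦH≋geometric VXᵍ-1≋ ⟩
    geometric g k -ₚ (geometric g k -ₚ constₚ (+ k)) ≈⟨ cancel (geometric g k) (constₚ (+ k)) ⟩
    constₚ (+ k)                            ∎)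
  where
  open ≋-Reasoning
  d = suc n
  g = suc h
  Xᵍ-1 = XN-1 g
  Xᵍ-1∣proper : Xᵍ-1 ∣ₚ ∏Φ d n
  Xᵍ-1∣proper = ∣ʳ-respˡ-≈ (≋-sym (XN-1≋∏Φ cf-g))
                  (∣ʳ-trans (∏Φ-∣ g (divides k d≡kg)) (∏Φ-monotone d g≤n))
  H = _∣ʳ_.quotient Xᵍ-1∣proper
  ΦH≋geometric : Φ d *ₚ H ≋ geometric g k
  ΦH≋geometric = monic-*ₚ-cancelˡ (Monic-XN-1 h) (Φ d *ₚ H) (geometric g k) (begin
    Xᵍ-1 *ₚ (Φ d *ₚ H)          ≈⟨ rotate Xᵍ-1 (Φ d) H ⟩
    (H *ₚ Xᵍ-1) *ₚ Φ d          ≈⟨ *ₚ-congʳ (Φ d) (_∣ʳ_.equality Xᵍ-1∣proper) ⟩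
    ∏Φ d n *ₚ Φ d               ≈⟨ XN-1≋proper*Φ {n} cf-d ⟨
    XN-1 d                      ≡⟨ cong XN-1 d≡kg ⟩
    XN-1 (k ℕ.* g)              ≈⟨ XN-1-*ₚ-geometric g k ⟨
    Xᵍ-1 *ₚ geometric g k       ∎)
    where
    rotate : ∀ X F H → X *ₚ (F *ₚ H) ≋ (H *ₚ X) *ₚ F
    rotate = solve-∀ ℤ[X]-acr
  V = _∣ʳ_.quotient (difference-divisible (geometric≈length {g} k))
  VXᵍ-1≋ : V *ₚ Xᵍ-1 ≋ geometric g k -ₚ constₚ (+ k)
  VXᵍ-1≋ = _∣ʳ_.equality (difference-divisible (geometric≈length {g} k))
  regroup : ∀ H Φ V X → H *ₚ Φ +ₚ negₚ V *ₚ X ≋ Φ *ₚ H -ₚ V *ₚ X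
  regroup = solve-∀ ℤ[X]-acr
  cancel : ∀ G K → G -ₚ (G -ₚ K) ≋ K
  cancel = solve-∀ ℤ[X]-acr
  k≢0 : + k ≢ + 0
  k≢0 refl = ℕ.1+n≢0 d≡kg

Φ-coprime-XN-1 : ∀ {d s} → CyclotomicFactorisation d → CyclotomicFactorisation (gcd d s) →
                 ¬ d ∣ s → Coprimeℚ (Φ d) (XN-1 s)
Φ-coprime-XN-1 {zero}  cf-d _ _ with () ← monic-leading (Φ-monic cf-d)
Φ-coprime-XN-1 {suc n} {s} cf-d cf-g d∤s with XN-1-gcd (suc n) s
... | A , B , XN-1-g≋ = Coprimeℚ-combination {A′ = A} {B′ = B}
  (Φ-coprime-XN-1-divisor cf-d cf-g g∣d g<d (0<gcd s (s≤s z≤n))) XN-1-g≋ (factorisation⇒Φ∣XN-1 cf-d)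
  where
  g∣d = gcd[m,n]∣m (suc n) s
  g<d : gcd (suc n) s ℕ.< suc n
  g<d = ℕ.≤∧≢⇒< (gcd≤ s (s≤s z≤n)) λ g≡d → d∤s (subst (_∣ s) g≡d (gcd[m,n]∣n (suc n) s))

CyclotomicUpTo : ℕ → Set
CyclotomicUpTo B = ∀ {m} → 0 ℕ.< m → m ℕ.≤ B → CyclotomicFactorisation m

Φ-coprime-Φ : ∀ {B d e} → CyclotomicUpTo B → 0 ℕ.< d → d ℕ.≤ B → 0 ℕ.< e → e ℕ.≤ B → d ≢ e →
              Coprimeℚ (Φ d) (Φ e)
Φ-coprime-Φ {B} {d} {e} cf 0<d d≤B 0<e e≤B d≢e with d ∣? e
... | no  d∤e = Coprimeℚ-∣ʳ (Φ-coprime-XN-1 (cf 0<d d≤B) (cf (0<gcd e 0<d) (ℕ.≤-trans (gcd≤ e 0<d) d≤B)) d∤e)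
                            (factorisation⇒Φ∣XN-1 (cf 0<e e≤B))
... | yes d∣e = Coprimeℚ-sym (Coprimeℚ-∣ʳ (Φ-coprime-XN-1 (cf 0<e e≤B) (cf (0<gcd d 0<e) (ℕ.≤-trans (gcd≤ d 0<e) e≤B)) e∤d)
                                          (factorisation⇒Φ∣XN-1 (cf 0<d d≤B)))
  where
  e∤d : ¬ e ∣ d
  e∤d e∣d = d≢e (∣-antisym d∣e e∣d)

module _ (n : ℕ) (cf : CyclotomicUpTo n) where

  Monic-∏Φ-below : ∀ m → m ℕ.≤ n → Monic (∏Φ (suc n) m)
  Monic-∏Φ-below m m≤n = Monic-∏Φ (suc n) m λ 0<d d≤m _ → Φ-monic (cf 0<d (ℕ.≤-trans d≤m m≤n))

  ∏Φ-below-∣-XN-1 : ∀ m → m ℕ.≤ n → ∏Φ (suc n) m ∣ₚ XN-1 (suc n)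
  ∏Φ-below-∣-XN-1 zero    _   = XN-1 (suc n) , *ₚ-identityʳ (XN-1 (suc n))
  ∏Φ-below-∣-XN-1 (suc m) m<n with suc m ∣? suc n
  ... | no  d∤N = ∣ʳ-respˡ-≈ (≋-sym (∏Φ-suc-∤ d∤N)) (∏Φ-below-∣-XN-1 m (ℕ.<⇒≤ m<n))
  ... | yes d∣N = ∣ʳ-respˡ-≈ (≋-sym (∏Φ-suc-∣ d∣N))
                    (monic-coprime-*ₚ-∣ (Monic-*ₚ (Monic-∏Φ-below m (ℕ.<⇒≤ m<n)) (Φ-monic cf-d)) coprime
                      (∏Φ-below-∣-XN-1 m (ℕ.<⇒≤ m<n)) (∣ʳ-trans (factorisation⇒Φ∣XN-1 cf-d) (XN-1-∣ d∣N)))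
    where
    cf-d = cf (s≤s z≤n) m<n
    coprime : Coprimeℚ (∏Φ (suc n) m) (Φ (suc m))
    coprime = Coprimeℚ-∏Φ m λ 0<e e≤m _ →
      Φ-coprime-Φ cf 0<e (ℕ.≤-trans e≤m (ℕ.<⇒≤ m<n)) (s≤s z≤n) m<n (ℕ.<⇒≢ (s≤s e≤m))

  cyclotomic-step : CyclotomicFactorisation (suc n)
  cyclotomic-step = record
    { Φ-monic = divMonic-monic (Monic-XN-1 n) (Monic-∏Φ-below n ℕ.≤-refl) (∏Φ-below-∣-XN-1 n ℕ.≤-refl)
    ; XN-1≋∏Φ = ≋-trans (≋-sym (divMonic-exact (Monic-∏Φ-below n ℕ.≤-refl) (∏Φ-below-∣-XN-1 n ℕ.≤-refl)))
                        (≋-trans (*ₚ-comm (Φ (suc n)) (∏Φ (suc n) n)) (≋-sym (∏Φ-suc-∣ {n = n} ℕ.∣-refl)))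
    }

cyclotomic : ∀ N → 0 ℕ.< N → CyclotomicFactorisation N
cyclotomic = <-rec (λ N → 0 ℕ.< N → CyclotomicFactorisation N) step
  where
  step : ∀ N → (∀ {m} → m ℕ.< N → 0 ℕ.< m → CyclotomicFactorisation m) → 0 ℕ.< N → CyclotomicFactorisation N
  step (suc n) below _ = cyclotomic-step n λ 0<m m≤n → below (s≤s m≤n) 0<m

Φ∣XN-1 : ∀ {N} → 0 ℕ.< N → Φ N ∣ₚ XN-1 N
Φ∣XN-1 {N} 0<N = factorisation⇒Φ∣XN-1 (cyclotomic N 0<N)

Φ-cancel : ∀ {N s G} → 0 ℕ.< N → ¬ N ∣ s → Φ N ∣ₚ XN-1 s *ₚ G → Φ N ∣ₚ G
Φ-cancel {N} {s} 0<N N∤s = monic-coprime-∣ (Φ-monic cf)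
  (Φ-coprime-XN-1 cf (cyclotomic (gcd N s) (0<gcd s 0<N)) N∤s)
  where cf = cyclotomic N 0<N

Φ∣Xᴹ+1 : ∀ {N M} → N ≡ M ℕ.+ M → 0 ℕ.< M → Φ N ∣ₚ monoₚ M +ₚ constₚ (+ 1)
Φ∣Xᴹ+1 {N} {M} N≡2M 0<M = Φ-cancel 0<N N∤M (∣ʳ-respʳ-≈ XN-1≋ (Φ∣XN-1 0<N))
  where
  0<N : 0 ℕ.< N
  0<N = subst (0 ℕ.<_) (sym N≡2M) (ℕ.<-≤-trans 0<M (ℕ.m≤m+n M M))
  N∤M : ¬ N ∣ M
  N∤M N∣M = ℕ.<⇒≱ (subst (M ℕ.<_) (sym N≡2M) (ℕ.m<m+n M 0<M)) (∣⇒≤ {{ℕ.>-nonZero 0<M}} N∣M)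
  difference-of-squares : ∀ Y → Y *ₚ Y -ₚ constₚ (+ 1) ≋ (Y -ₚ constₚ (+ 1)) *ₚ (Y +ₚ constₚ (+ 1))
  difference-of-squares = solve-∀ ℤ[X]-acr
  XN-1≋ : XN-1 N ≋ XN-1 M *ₚ (monoₚ M +ₚ constₚ (+ 1))
  XN-1≋ = ≋-trans (≡⇒≋ (cong XN-1 N≡2M))
                  (≋-trans (-ₚ-cong (monoₚ-+ M M) ≋-refl) (difference-of-squares (monoₚ M)))

-- Ramanujan sums at a root of unity

gcdClassSum : ℕ → ℕ → ℕ → Poly
gcdClassSum m s e = Σ< m (λ a → if does (gcd a m ℕ.≟ e) then monoₚ (a ℕ.* s) else [])

ramanujanSum : ℕ → ℕ → Poly
ramanujanSum m s = gcdClassSum m s 1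

geometric≋Σ-gcdClassSum : ∀ {m} s → 0 ℕ.< m → geometric s m ≋ Σ< (suc m) (gcdClassSum m s)
geometric≋Σ-gcdClassSum {m} s 0<m = Σ<-partition m (suc m) (λ a → gcd a m) (λ a → monoₚ (a ℕ.* s))
  λ a _ → s≤s (gcd[m,n]≤n a m {{ℕ.>-nonZero 0<m}})

gcdClassSum-zero : ∀ {m} s → 0 ℕ.< m → gcdClassSum m s 0 ≋ []
gcdClassSum-zero {m} s 0<m = Σ<-zero m λ a _ →
  if-no (gcd a m ℕ.≟ 0) _ (gcd[m,n]≢0 a m (inj₂ (ℕ.n>0⇒n≢0 0<m)))

gcdClassSum-∤ : ∀ {m e} s → ¬ e ∣ m → gcdClassSum m s e ≋ []
gcdClassSum-∤ {m} {e} s e∤m = Σ<-zero m λ a _ →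
  if-no (gcd a m ℕ.≟ e) _ λ gcd≡e → e∤m (subst (_∣ m) gcd≡e (gcd[m,n]∣n a m))

-- a = b·e + r with 0 ≤ r < e; only r = 0 can have gcd (a, k·e) = e, and then gcd (b, k) = 1
gcdClassSum-multiple : ∀ k {e} s → 0 ℕ.< e → gcdClassSum (k ℕ.* e) s e ≋ ramanujanSum k (e ℕ.* s)
gcdClassSum-multiple k {suc e′} s _ = ≋-trans (Σ<-blocks k e _) (Σ<-cong k λ b _ → block b)
  where
  e = suc e′
  term : ℕ → Poly
  term a = if does (gcd a (k ℕ.* e) ℕ.≟ e) then monoₚ (a ℕ.* s) else []
  gcd-block : ∀ b → gcd (b ℕ.* e ℕ.+ 0) (k ℕ.* e) ≡ gcd b k ℕ.* e
  gcd-block b = begin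
    gcd (b ℕ.* e ℕ.+ 0) (k ℕ.* e)   ≡⟨ cong₂ gcd (trans (ℕ.+-identityʳ _) (ℕ.*-comm b e)) (ℕ.*-comm k e) ⟩
    gcd (e ℕ.* b) (e ℕ.* k)         ≡⟨ c*gcd[m,n]≡gcd[cm,cn] e b k ⟨
    e ℕ.* gcd b k                   ≡⟨ ℕ.*-comm e (gcd b k) ⟩
    gcd b k ℕ.* e                   ∎
    where open ≡-Reasoning
  first : ∀ b → term (b ℕ.* e ℕ.+ 0) ≋ (if does (gcd b k ℕ.≟ 1) then monoₚ (b ℕ.* (e ℕ.* s)) else [])
  first b = if-⇔ (gcd (b ℕ.* e ℕ.+ 0) (k ℕ.* e) ℕ.≟ e) (gcd b k ℕ.≟ 1)
    (λ gcd≡e → ℕ.*-cancelʳ-≡ (gcd b k) 1 e (trans (sym (gcd-block b)) (trans gcd≡e (sym (ℕ.*-identityˡ e)))))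
    (λ gcd≡1 → trans (gcd-block b) (trans (cong (ℕ._* e) gcd≡1) (ℕ.*-identityˡ e)))
    (≡⇒≋ (cong monoₚ (trans (cong (ℕ._* s) (ℕ.+-identityʳ (b ℕ.* e))) (ℕ.*-assoc b e s))))
  rest : ∀ b r → r ℕ.< e′ → term (b ℕ.* e ℕ.+ suc r) ≋ []
  rest b r r<e′ = if-no (gcd (b ℕ.* e ℕ.+ suc r) (k ℕ.* e) ℕ.≟ e) _ λ gcd≡e →
    ℕ.<⇒≱ (s≤s r<e′) (ℕ.∣⇒≤ (ℕ.∣m+n∣m⇒∣n (subst (_∣ b ℕ.* e ℕ.+ suc r) gcd≡e (gcd[m,n]∣m _ _)) (ℕ.n∣m*n b)))
  block : ∀ b → Σ< e (λ r → term (b ℕ.* e ℕ.+ r)) ≋ (if does (gcd b k ℕ.≟ 1) then monoₚ (b ℕ.* (e ℕ.* s)) else [])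
  block b = ≋-trans (Σ<-shift e′ _)
                    (≋-trans (+ₚ-cong (first b) (Σ<-zero e′ λ r r<e′ → rest b r r<e′)) (+ₚ-identityʳ _))

geometric-constant : ∀ {N} s m → 0 ℕ.< N → N ∣ m ℕ.* s → ConstantMod (Φ N) (geometric s m)
geometric-constant {N} s m 0<N N∣ms with N ∣? s
... | yes N∣s = + m , ≈mod-weaken (∣ʳ-trans (Φ∣XN-1 0<N) (XN-1-∣ N∣s)) (geometric≈length {s} m)
... | no  N∤s = ConstantMod-resp (∣ₚ⇒≈[] (Φ-cancel 0<N N∤s Φ∣XN-1*geometric)) (ConstantMod-zero ≋-refl)
  where
  Φ∣XN-1*geometric : Φ N ∣ₚ XN-1 s *ₚ geometric s m
  Φ∣XN-1*geometric = ∣ʳ-respʳ-≈ (≋-sym (XN-1-*ₚ-geometric s m)) (∣ʳ-trans (Φ∣XN-1 0<N) (XN-1-∣ N∣ms))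

ramanujanSum≋geometric-otherClasses : ∀ {m} s → 0 ℕ.< m →
  ramanujanSum m s ≋ geometric s m -ₚ Σ< (suc m) (λ e → if does (1 ℕ.≟ e) then [] else gcdClassSum m s e)
ramanujanSum≋geometric-otherClasses {m} s 0<m = ≋-trans (isolate (ramanujanSum m s) _)
  (-ₚ-cong (≋-sym (≋-trans (geometric≋Σ-gcdClassSum s 0<m) (Σ<-pull (suc m) (gcdClassSum m s) (s≤s 0<m)))) ≋-refl)
  where
  isolate : ∀ R O → R ≋ (R +ₚ O) -ₚ O
  isolate = solve-∀ ℤ[X]-acr

module _ {N : ℕ} (0<N : 0 ℕ.< N) where

  RamanujanSumsConstant : ℕ → Set
  RamanujanSumsConstant m = ∀ s → 0 ℕ.< m → N ∣ m ℕ.* s → ConstantMod (Φ N) (ramanujanSum m s)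

  gcdClassSum-constant : ∀ {m s} → (∀ {k} → k ℕ.< m → RamanujanSumsConstant k) → 0 ℕ.< m → N ∣ m ℕ.* s →
                         ∀ e → ConstantMod (Φ N) (if does (1 ℕ.≟ e) then [] else gcdClassSum m s e)
  gcdClassSum-constant {m} {s} below 0<m N∣ms zero = ConstantMod-zero (gcdClassSum-zero s 0<m)
  gcdClassSum-constant {m} {s} below 0<m N∣ms (suc zero) = ConstantMod-zero ≋-refl
  gcdClassSum-constant {m} {s} below 0<m N∣ms e@(suc (suc _)) with e ∣? m
  ... | no  e∤m = ConstantMod-zero (gcdClassSum-∤ s e∤m)
  ... | yes (divides k m≡ke) = ConstantMod-resp (≋⇒≈mod class≋) (below k<m (e ℕ.* s) 0<k N∣k[es])
    where
    class≋ : gcdClassSum m s e ≋ ramanujanSum k (e ℕ.* s)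
    class≋ = ≋-trans (≡⇒≋ (cong (λ m → gcdClassSum m s e) m≡ke)) (gcdClassSum-multiple k s (s≤s z≤n))
    0<k : 0 ℕ.< k
    0<k = ℕ.n≢0⇒n>0 λ k≡0 → ℕ.n>0⇒n≢0 0<m (trans m≡ke (cong (ℕ._* e) k≡0))
    k<m : k ℕ.< m
    k<m = subst (k ℕ.<_) (sym m≡ke) (ℕ.m<m*n k e {{ℕ.>-nonZero 0<k}} (s≤s (s≤s z≤n)))
    N∣k[es] : N ∣ k ℕ.* (e ℕ.* s)
    N∣k[es] = subst (N ∣_) (trans (cong (ℕ._* s) m≡ke) (ℕ.*-assoc k e s)) N∣ms

  ramanujanSum-constant : ∀ m → RamanujanSumsConstant m
  ramanujanSum-constant = <-rec RamanujanSumsConstant λ m below s 0<m N∣ms →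
    ConstantMod-resp (≋⇒≈mod (ramanujanSum≋geometric-otherClasses s 0<m))
      (ConstantMod-+ₚ (geometric-constant s m 0<N N∣ms)
        (ConstantMod-negₚ (ConstantMod-Σ< (suc m) λ e _ → gcdClassSum-constant below 0<m N∣ms e)))

-- Units modulo a multiple of 3

gcd[m∸a,m]≡gcd[a,m] : ∀ {m a} → a ℕ.≤ m → gcd (m ∸ a) m ≡ gcd a m
gcd[m∸a,m]≡gcd[a,m] {m} {a} a≤m = ℕ.∣-antisym
  (gcd-greatest (ℕ.∣m+n∣m⇒∣n (subst (gcd (m ∸ a) m ∣_) (sym (ℕ.m∸n+n≡m a≤m)) (gcd[m,n]∣n (m ∸ a) m))
                             (gcd[m,n]∣m (m ∸ a) m))
                (gcd[m,n]∣n (m ∸ a) m))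
  (gcd-greatest (ℕ.∣m+n∣m⇒∣n (subst (gcd a m ∣_) (sym (ℕ.m+[n∸m]≡n a≤m)) (gcd[m,n]∣n a m)) (gcd[m,n]∣m a m))
                (gcd[m,n]∣n a m))

residues-sum-to-0 : ∀ r r′ → r ℕ.< 3 → r′ ℕ.< 3 → (r′ ℕ.+ r) % 3 ≡ 0 → r′ ≡ (3 ∸ r) % 3
residues-sum-to-0 0 0 _ _ _ = refl
residues-sum-to-0 1 2 _ _ _ = refl
residues-sum-to-0 2 1 _ _ _ = refl
residues-sum-to-0 0 1 _ _ ()
residues-sum-to-0 0 2 _ _ ()
residues-sum-to-0 1 0 _ _ ()
residues-sum-to-0 1 1 _ _ ()
residues-sum-to-0 2 0 _ _ ()
residues-sum-to-0 2 2 _ _ ()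
residues-sum-to-0 (suc (suc (suc _))) _ (s≤s (s≤s (s≤s ()))) _ _
residues-sum-to-0 _ (suc (suc (suc _))) _ (s≤s (s≤s (s≤s ()))) _

[3∸r]%3≡1⇒r≡2 : ∀ r → r ℕ.< 3 → (3 ∸ r) % 3 ≡ 1 → r ≡ 2
[3∸r]%3≡1⇒r≡2 2 _ _ = refl
[3∸r]%3≡1⇒r≡2 0 _ ()
[3∸r]%3≡1⇒r≡2 1 _ ()
[3∸r]%3≡1⇒r≡2 (suc (suc (suc _))) (s≤s (s≤s (s≤s ()))) _

complement-residue : ∀ {m} a → 3 ∣ m → a ℕ.≤ m → (m ∸ a) % 3 ≡ (3 ∸ a % 3) % 3
complement-residue {m} a (divides c m≡c3) a≤m =
  residues-sum-to-0 (a % 3) ((m ∸ a) % 3) (m%n<n a 3) (m%n<n (m ∸ a) 3) (begin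
  ((m ∸ a) % 3 ℕ.+ a % 3) % 3     ≡⟨ %-distribˡ-+ (m ∸ a) a 3 ⟨
  (m ∸ a ℕ.+ a) % 3               ≡⟨ cong (_% 3) (trans (ℕ.m∸n+n≡m a≤m) m≡c3) ⟩
  (c ℕ.* 3) % 3                   ≡⟨ m*n%n≡0 c 3 ⟩
  0                               ∎)
  where open ≡-Reasoning

coprime-residue : ∀ {m} a → 3 ∣ m → gcd a m ≡ 1 → a % 3 ≡ 1 ⊎ a % 3 ≡ 2
coprime-residue {m} a 3∣m gcd≡1 with a % 3 in a%3 | m%n<n a 3
... | 0 | _ = ⊥-elim (3∤1 (subst (3 ∣_) gcd≡1 (gcd-greatest 3∣a 3∣m)))
  where
  3∣a : 3 ∣ a
  3∣a = divides (a / 3) (trans (m≡m%n+[m/n]*n a 3) (cong (ℕ._+ a / 3 ℕ.* 3) a%3))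
  3∤1 : ¬ 3 ∣ 1
  3∤1 3∣1 = ℕ.<⇒≱ (s≤s (s≤s z≤n)) (∣⇒≤ 3∣1)
... | 1 | _ = inj₁ refl
... | 2 | _ = inj₂ refl
... | suc (suc (suc _)) | s≤s (s≤s (s≤s ()))

gcd≡1⇒0< : ∀ {a m} → 1 ℕ.< m → gcd a m ≡ 1 → 0 ℕ.< a
gcd≡1⇒0< {zero}  {m} 1<m gcd≡1 = ⊥-elim (ℕ.<⇒≢ 1<m (sym (trans (sym (gcd-identityˡ m)) gcd≡1)))
gcd≡1⇒0< {suc a} _ _ = s≤s z≤n

-- Characters and the sum Z_x(α)

sumFin-cong : ∀ {k} {f g : Fin k → ℕ} → (∀ j → f j ≡ g j) → sumFin f ≡ sumFin g
sumFin-cong {zero}  f≡g = refl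
sumFin-cong {suc k} f≡g = cong₂ ℕ._+_ (f≡g Fin.zero) (sumFin-cong (λ j → f≡g (Fin.suc j)))

sumFin-+ : ∀ {k} (f g : Fin k → ℕ) → sumFin (λ j → f j ℕ.+ g j) ≡ sumFin f ℕ.+ sumFin g
sumFin-+ {zero}  f g = refl
sumFin-+ {suc k} f g =
  trans (cong (f Fin.zero ℕ.+ g Fin.zero ℕ.+_) (sumFin-+ (λ j → f (Fin.suc j)) (λ j → g (Fin.suc j))))
        (interchange (f Fin.zero) (g Fin.zero) _ _)
  where
  interchange : ∀ a b c d → a ℕ.+ b ℕ.+ (c ℕ.+ d) ≡ a ℕ.+ c ℕ.+ (b ℕ.+ d)
  interchange = NatSolver.solve-∀

sumFin-*ˡ : ∀ {k} c (f : Fin k → ℕ) → sumFin (λ j → c ℕ.* f j) ≡ c ℕ.* sumFin f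
sumFin-*ˡ {zero}  c f = sym (ℕ.*-zeroʳ c)
sumFin-*ˡ {suc k} c f = trans (cong (c ℕ.* f Fin.zero ℕ.+_) (sumFin-*ˡ c (λ j → f (Fin.suc j))))
                              (sym (ℕ.*-distribˡ-+ c (f Fin.zero) _))

sumFin-*ʳ : ∀ {k} c (f : Fin k → ℕ) → sumFin (λ j → f j ℕ.* c) ≡ sumFin f ℕ.* c
sumFin-*ʳ {zero}  c f = refl
sumFin-*ʳ {suc k} c f = trans (cong (f Fin.zero ℕ.* c ℕ.+_) (sumFin-*ʳ c (λ j → f (Fin.suc j))))
                              (sym (ℕ.*-distribʳ-+ c (f Fin.zero) _))

sumFin-zero : ∀ k → sumFin {k} (λ _ → 0) ≡ 0
sumFin-zero zero    = refl
sumFin-zero (suc k) = sumFin-zero k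

prodFin-∣ : ∀ {k} (f : Fin k → ℕ) j → f j ∣ prodFin f
prodFin-∣ f Fin.zero    = m∣m*n (prodFin (λ j → f (Fin.suc j)))
prodFin-∣ f (Fin.suc j) = ℕ.∣-trans (prodFin-∣ (λ j → f (Fin.suc j)) j) (n∣m*n (f Fin.zero))

prodFin-positive : ∀ {k} (f : Fin k → ℕ) → (∀ j → NonZero (f j)) → 0 ℕ.< prodFin f
prodFin-positive {zero}  f nz = ℕ.≤-refl
prodFin-positive {suc k} f nz =
  ℕ.*-mono-≤ (ℕ.>-nonZero⁻¹ (f Fin.zero) {{nz Fin.zero}}) (prodFin-positive (λ j → f (Fin.suc j)) (λ j → nz (Fin.suc j)))

≈constₚ⇒IsIntegerAt : ∀ {L p c} → p ≈ constₚ c mod Φ L → IsIntegerAt L p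
≈constₚ⇒IsIntegerAt {L} {p} {c} (divides-difference (Q , QΦ≋)) = c , Q , coeff-≡ (≋-trans (≋-sym QΦ≋) (*ₚ-comm Q (Φ L)))

module _ (k : ℕ) (n : Fin k → ℕ) (nz : (j : Fin k) → NonZero (n j)) where
  open Grp k n nz

  private
    w : Fin k → ℕ
    w j = (L / n j) {{nz j}}

    n*w≡L : ∀ j → n j ℕ.* w j ≡ L
    n*w≡L j = m*[n/m]≡n {{nz j}} (ℕ.∣-trans (prodFin-∣ n j) (n∣m*n 6))

    summand-split : ∀ j c {u r q} → u ≡ r ℕ.+ q ℕ.* n j → c ℕ.* u ℕ.* w j ≡ c ℕ.* r ℕ.* w j ℕ.+ (c ℕ.* q) ℕ.* L
    summand-split j c {u} {r} {q} refl = trans (expand c r q (n j) (w j)) (cong (λ z → c ℕ.* r ℕ.* w j ℕ.+ (c ℕ.* q) ℕ.* z) (n*w≡L j))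
      where
      expand : ∀ c r q n w → c ℕ.* (r ℕ.+ q ℕ.* n) ℕ.* w ≡ c ℕ.* r ℕ.* w ℕ.+ (c ℕ.* q) ℕ.* (n ℕ.* w)
      expand = NatSolver.solve-∀

    toℕ-mod : ∀ u j → toℕ ((u mod n j) {{nz j}}) ≡ (u % n j) {{nz j}}
    toℕ-mod u j = toℕ-fromℕ< _

    reduce : ∀ u j → u ≡ toℕ ((u mod n j) {{nz j}}) ℕ.+ (u / n j) {{nz j}} ℕ.* n j
    reduce u j = trans (m≡m%n+[m/n]*n u (n j) {{nz j}}) (cong (ℕ._+ (u / n j) {{nz j}} ℕ.* n j) (sym (toℕ-mod u j)))

  ψexp-pow : ∀ (α x : Elt) a → ∃ λ Q → a ℕ.* ψexp α x ≡ ψexp α (pow x a) ℕ.+ Q ℕ.* L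
  ψexp-pow α x a = sumFin q , (begin
    a ℕ.* ψexp α x                                         ≡⟨ sumFin-*ˡ a (λ j → toℕ (α j) ℕ.* toℕ (x j) ℕ.* w j) ⟨
    sumFin (λ j → a ℕ.* (toℕ (α j) ℕ.* toℕ (x j) ℕ.* w j)) ≡⟨ sumFin-cong per-coordinate ⟩
    sumFin (λ j → toℕ (α j) ℕ.* toℕ (pow x a j) ℕ.* w j ℕ.+ q j ℕ.* L)
                                                           ≡⟨ sumFin-+ (λ j → toℕ (α j) ℕ.* toℕ (pow x a j) ℕ.* w j) (λ j → q j ℕ.* L) ⟩
    ψexp α (pow x a) ℕ.+ sumFin (λ j → q j ℕ.* L)          ≡⟨ cong (ψexp α (pow x a) ℕ.+_) (sumFin-*ʳ L q) ⟩
    ψexp α (pow x a) ℕ.+ sumFin q ℕ.* L                    ∎)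
    where
    open ≡-Reasoning
    q : Fin k → ℕ
    q j = toℕ (α j) ℕ.* (a ℕ.* toℕ (x j) / n j) {{nz j}}
    per-coordinate : ∀ j → a ℕ.* (toℕ (α j) ℕ.* toℕ (x j) ℕ.* w j) ≡ toℕ (α j) ℕ.* toℕ (pow x a j) ℕ.* w j ℕ.+ q j ℕ.* L
    per-coordinate j = trans (regroup a (toℕ (α j)) (toℕ (x j)) (w j)) (summand-split j (toℕ (α j)) (reduce (a ℕ.* toℕ (x j)) j))
      where
      regroup : ∀ a c x w → a ℕ.* (c ℕ.* x ℕ.* w) ≡ c ℕ.* (a ℕ.* x) ℕ.* w
      regroup = NatSolver.solve-∀

  ψexp-neg : ∀ (α s : Elt) → ∃₂ λ Q R → ψexp α (neg s) ℕ.+ ψexp α s ℕ.+ Q ℕ.* L ≡ R ℕ.* L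
  ψexp-neg α s = sumFin q , sumFin (λ j → toℕ (α j)) , (begin
    ψexp α (neg s) ℕ.+ ψexp α s ℕ.+ sumFin q ℕ.* L
      ≡⟨ cong₂ ℕ._+_ (sumFin-+ summand-neg summand) (sumFin-*ʳ L q) ⟨
    sumFin (λ j → summand-neg j ℕ.+ summand j) ℕ.+ sumFin (λ j → q j ℕ.* L)
      ≡⟨ sumFin-+ (λ j → summand-neg j ℕ.+ summand j) (λ j → q j ℕ.* L) ⟨
    sumFin (λ j → summand-neg j ℕ.+ summand j ℕ.+ q j ℕ.* L)
      ≡⟨ sumFin-cong per-coordinate ⟩
    sumFin (λ j → toℕ (α j) ℕ.* L)
      ≡⟨ sumFin-*ʳ L (λ j → toℕ (α j)) ⟩
    sumFin (λ j → toℕ (α j)) ℕ.* L ∎)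
    where
    open ≡-Reasoning
    summand-neg summand : Fin k → ℕ
    summand-neg j = toℕ (α j) ℕ.* toℕ (neg s j) ℕ.* w j
    summand     j = toℕ (α j) ℕ.* toℕ (s j) ℕ.* w j
    u : Fin k → ℕ
    u j = n j ∸ toℕ (s j)
    q : Fin k → ℕ
    q j = toℕ (α j) ℕ.* (u j / n j) {{nz j}}
    per-coordinate : ∀ j → summand-neg j ℕ.+ summand j ℕ.+ q j ℕ.* L ≡ toℕ (α j) ℕ.* L
    per-coordinate j = begin
      summand-neg j ℕ.+ summand j ℕ.+ q j ℕ.* L     ≡⟨ swap (summand-neg j) (summand j) (q j ℕ.* L) ⟩
      summand-neg j ℕ.+ q j ℕ.* L ℕ.+ summand j     ≡⟨ cong (ℕ._+ summand j) (summand-split j (toℕ (α j)) (reduce (u j) j)) ⟨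
      toℕ (α j) ℕ.* u j ℕ.* w j ℕ.+ summand j       ≡⟨ factor (toℕ (α j)) (u j) (toℕ (s j)) (w j) ⟩
      toℕ (α j) ℕ.* (u j ℕ.+ toℕ (s j)) ℕ.* w j     ≡⟨ cong (λ z → toℕ (α j) ℕ.* z ℕ.* w j) (ℕ.m∸n+n≡m (ℕ.<⇒≤ (toℕ<n (s j)))) ⟩
      toℕ (α j) ℕ.* n j ℕ.* w j                     ≡⟨ trans (ℕ.*-assoc (toℕ (α j)) (n j) (w j)) (cong (toℕ (α j) ℕ.*_) (n*w≡L j)) ⟩
      toℕ (α j) ℕ.* L                               ∎
      where
      swap : ∀ a b c → a ℕ.+ b ℕ.+ c ≡ a ℕ.+ c ℕ.+ b
      swap = NatSolver.solve-∀
      factor : ∀ c u s w → c ℕ.* u ℕ.* w ℕ.+ c ℕ.* s ℕ.* w ≡ c ℕ.* (u ℕ.+ s) ℕ.* w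
      factor = NatSolver.solve-∀

  ψexp-identity : ∀ (α y : Elt) → IsIdentity y → ψexp α y ≡ 0
  ψexp-identity α y y≡0 = trans (sumFin-cong summand≡0) (sumFin-zero k)
    where
    summand≡0 : ∀ j → toℕ (α j) ℕ.* toℕ (y j) ℕ.* w j ≡ 0
    summand≡0 j rewrite y≡0 j | ℕ.*-zeroʳ (toℕ (α j)) = refl

  P : ℕ
  P = prodFin n

  0<P : 0 ℕ.< P
  0<P = prodFin-positive n nz

  0<L : 0 ℕ.< L
  0<L = ℕ.<-≤-trans 0<P (ℕ.m≤n*m P 6)

  L/6≡P : L / 6 ≡ P
  L/6≡P = trans (cong (_/ 6) (ℕ.*-comm 6 P)) (m*n/n≡m P 6)

  mod-XN-1⇒mod-Φ : ∀ {p q} → p ≈ q mod XN-1 L → p ≈ q mod Φ L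
  mod-XN-1⇒mod-Φ = ≈mod-weaken (Φ∣XN-1 0<L)

  X³ᴾ≈-1 : monoₚ (3 ℕ.* P) ≈ negₚ (constₚ (+ 1)) mod Φ L
  X³ᴾ≈-1 = divides-difference (∣ʳ-respʳ-≈ (plus-as-minus (monoₚ (3 ℕ.* P)))
             (Φ∣Xᴹ+1 (L≡3P+3P P) (ℕ.<-≤-trans 0<P (ℕ.m≤n*m P 3))))
    where
    L≡3P+3P : ∀ P → 6 ℕ.* P ≡ 3 ℕ.* P ℕ.+ 3 ℕ.* P
    L≡3P+3P = NatSolver.solve-∀
    plus-as-minus : ∀ Y → Y +ₚ constₚ (+ 1) ≋ Y -ₚ negₚ (constₚ (+ 1))
    plus-as-minus = solve-∀ ℤ[X]-acr

  module _ (x : Elt) (m : ℕ) (ord : IsOrder x m) (3∣m : 3 ∣ m) (α : Elt) where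
    t s : ℕ
    t = ψexp α x
    s = t ℕ.+ 4 ℕ.* P

    0<m : 0 ℕ.< m
    0<m = proj₁ ord

    mt≡QL : ∃ λ Q → m ℕ.* t ≡ Q ℕ.* L
    mt≡QL with ψexp-pow α x m
    ... | Q , eq = Q , trans eq (cong (ℕ._+ Q ℕ.* L) (ψexp-identity α (pow x m) (proj₁ (proj₂ ord))))

    L∣ms : L ∣ m ℕ.* s
    L∣ms with mt≡QL
    ... | Q , mt≡ = divides (Q ℕ.+ 2 ℕ.* c) (begin
      m ℕ.* (t ℕ.+ 4 ℕ.* P)              ≡⟨ ℕ.*-distribˡ-+ m t (4 ℕ.* P) ⟩
      m ℕ.* t ℕ.+ m ℕ.* (4 ℕ.* P)        ≡⟨ cong₂ (λ u v → u ℕ.+ v ℕ.* (4 ℕ.* P)) mt≡ m≡3c ⟩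
      Q ℕ.* L ℕ.+ c ℕ.* 3 ℕ.* (4 ℕ.* P)  ≡⟨ regroup Q c P ⟩
      (Q ℕ.+ 2 ℕ.* c) ℕ.* L              ∎)
      where
      open ≡-Reasoning
      c = ℕ._∣_.quotient 3∣m
      m≡3c = ℕ._∣_.equality 3∣m
      regroup : ∀ Q c P → Q ℕ.* (6 ℕ.* P) ℕ.+ c ℕ.* 3 ℕ.* (4 ℕ.* P) ≡ (Q ℕ.+ 2 ℕ.* c) ℕ.* (6 ℕ.* P)
      regroup = NatSolver.solve-∀

    twisted : ∀ j {c e} → monoₚ c ≈ monoₚ (3 ℕ.* P ℕ.+ 4 ℕ.* P ℕ.* j) mod XN-1 L →
              monoₚ e ≈ monoₚ (j ℕ.* t) mod XN-1 L → monoₚ (c ℕ.+ e) ≈ negₚ (monoₚ (j ℕ.* s)) mod Φ L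
    twisted j {c} {e} c≈ e≈ = begin
      monoₚ (c ℕ.+ e)                                       ≈⟨ ≋⇒≈mod (monoₚ-+ c e) ⟩
      monoₚ c *ₚ monoₚ e                                    ≈⟨ mod-XN-1⇒mod-Φ (*ₚ-cong-mod c≈ e≈) ⟩
      monoₚ (3 ℕ.* P ℕ.+ 4 ℕ.* P ℕ.* j) *ₚ monoₚ (j ℕ.* t)   ≈⟨ ≋⇒≈mod (monoₚ-+ (3 ℕ.* P ℕ.+ 4 ℕ.* P ℕ.* j) (j ℕ.* t)) ⟨
      monoₚ (3 ℕ.* P ℕ.+ 4 ℕ.* P ℕ.* j ℕ.+ j ℕ.* t)           ≡⟨ cong monoₚ (exponent P t j) ⟩
      monoₚ (3 ℕ.* P ℕ.+ j ℕ.* s)                           ≈⟨ ≋⇒≈mod (monoₚ-+ (3 ℕ.* P) (j ℕ.* s)) ⟩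
      monoₚ (3 ℕ.* P) *ₚ monoₚ (j ℕ.* s)                    ≈⟨ *ₚ-cong-mod X³ᴾ≈-1 (≈mod-refl {p = monoₚ (j ℕ.* s)}) ⟩
      negₚ (constₚ (+ 1)) *ₚ monoₚ (j ℕ.* s)                ≈⟨ ≋⇒≈mod (sign (monoₚ (j ℕ.* s))) ⟩
      negₚ (monoₚ (j ℕ.* s))                                ∎
      where
      open ≈mod-Reasoning (Φ L)
      exponent : ∀ P t j → 3 ℕ.* P ℕ.+ 4 ℕ.* P ℕ.* j ℕ.+ j ℕ.* t ≡ 3 ℕ.* P ℕ.+ j ℕ.* (t ℕ.+ 4 ℕ.* P)
      exponent = NatSolver.solve-∀
      sign : ∀ Y → negₚ (constₚ (+ 1)) *ₚ Y ≋ negₚ Y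
      sign = solve-∀ ℤ[X]-acr

    term≈ : ∀ a → a ℕ.< m → a % 3 ≡ 1 →
            term α (pow x a) ≈ negₚ (monoₚ (a ℕ.* s) +ₚ monoₚ ((m ∸ a) ℕ.* s)) mod Φ L
    term≈ a a<m a%3≡1 = ≈mod-trans (+ₚ-cong-mod ω₆-term ω₆⁵-term)
      (≋⇒≈mod (≋-sym (scaleₚ-distribˡ (ℤ.- + 1) (monoₚ (a ℕ.* s)) (monoₚ ((m ∸ a) ℕ.* s)))))
      where
      ψ ψ⁻ : ℕ
      ψ  = ψexp α (pow x a)
      ψ⁻ = ψexp α (neg (pow x a))
      d  = m ∸ a
      Q  = proj₁ (ψexp-pow α x a)
      at≡ψ+QL : a ℕ.* t ≡ ψ ℕ.+ Q ℕ.* L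
      at≡ψ+QL = proj₂ (ψexp-pow α x a)
      Xᵠ≈Xᵃᵗ : monoₚ ψ ≈ monoₚ (a ℕ.* t) mod XN-1 L
      Xᵠ≈Xᵃᵗ = monoₚ-cong Q 0 (trans (sym at≡ψ+QL) (sym (ℕ.+-identityʳ (a ℕ.* t))))
      Xᵠ⁻≈Xᵈᵗ : monoₚ ψ⁻ ≈ monoₚ (d ℕ.* t) mod XN-1 L
      Xᵠ⁻≈Xᵈᵗ with ψexp-neg α (pow x a) | mt≡QL
      ... | Q′ , R′ , ψ⁻+ψ+Q′L≡R′L | Qm , mt≡QmL = monoₚ-cong (Qm ℕ.+ Q′) (Q ℕ.+ R′) (begin
        ψ⁻ ℕ.+ (Qm ℕ.+ Q′) ℕ.* L                          ≡⟨ cong (ψ⁻ ℕ.+_) (ℕ.*-distribʳ-+ L Qm Q′) ⟩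
        ψ⁻ ℕ.+ (Qm ℕ.* L ℕ.+ Q′ ℕ.* L)                    ≡⟨ cong (λ z → ψ⁻ ℕ.+ (z ℕ.+ Q′ ℕ.* L)) mt≡QmL ⟨
        ψ⁻ ℕ.+ (m ℕ.* t ℕ.+ Q′ ℕ.* L)                     ≡⟨ cong (λ z → ψ⁻ ℕ.+ (z ℕ.+ Q′ ℕ.* L)) mt≡dt+at ⟩
        ψ⁻ ℕ.+ (d ℕ.* t ℕ.+ a ℕ.* t ℕ.+ Q′ ℕ.* L)         ≡⟨ cong (λ z → ψ⁻ ℕ.+ (d ℕ.* t ℕ.+ z ℕ.+ Q′ ℕ.* L)) at≡ψ+QL ⟩
        ψ⁻ ℕ.+ (d ℕ.* t ℕ.+ (ψ ℕ.+ Q ℕ.* L) ℕ.+ Q′ ℕ.* L) ≡⟨ regroup ψ⁻ (d ℕ.* t) ψ (Q ℕ.* L) (Q′ ℕ.* L) ⟩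
        d ℕ.* t ℕ.+ Q ℕ.* L ℕ.+ (ψ⁻ ℕ.+ ψ ℕ.+ Q′ ℕ.* L)   ≡⟨ cong (d ℕ.* t ℕ.+ Q ℕ.* L ℕ.+_) ψ⁻+ψ+Q′L≡R′L ⟩
        d ℕ.* t ℕ.+ Q ℕ.* L ℕ.+ R′ ℕ.* L                  ≡⟨ factor (d ℕ.* t) Q R′ L ⟩
        d ℕ.* t ℕ.+ (Q ℕ.+ R′) ℕ.* L                      ∎)
        where
        open ≡-Reasoning
        mt≡dt+at : m ℕ.* t ≡ d ℕ.* t ℕ.+ a ℕ.* t
        mt≡dt+at = trans (cong (ℕ._* t) (sym (ℕ.m∸n+n≡m (ℕ.<⇒≤ a<m)))) (ℕ.*-distribʳ-+ t d a)
        regroup : ∀ u v w y z → u ℕ.+ (v ℕ.+ (w ℕ.+ y) ℕ.+ z) ≡ v ℕ.+ y ℕ.+ (u ℕ.+ w ℕ.+ z)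
        regroup = NatSolver.solve-∀
        factor : ∀ u Q R L → u ℕ.+ Q ℕ.* L ℕ.+ R ℕ.* L ≡ u ℕ.+ (Q ℕ.+ R) ℕ.* L
        factor = NatSolver.solve-∀
      b = a / 3
      a≡1+3b : a ≡ 1 ℕ.+ b ℕ.* 3
      a≡1+3b = trans (m≡m%n+[m/n]*n a 3) (cong (ℕ._+ b ℕ.* 3) a%3≡1)
      e = d / 3
      d≡2+3e : d ≡ 2 ℕ.+ e ℕ.* 3
      d≡2+3e = trans (m≡m%n+[m/n]*n d 3)
        (cong (ℕ._+ e ℕ.* 3) (trans (complement-residue a 3∣m (ℕ.<⇒≤ a<m)) (cong (λ r → (3 ∸ r) % 3) a%3≡1)))
      ω₆≈ : monoₚ P ≈ monoₚ (3 ℕ.* P ℕ.+ 4 ℕ.* P ℕ.* a) mod XN-1 L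
      ω₆≈ = monoₚ-cong (1 ℕ.+ 2 ℕ.* b) 0 (trans (exponent P b) (cong (λ a → 3 ℕ.* P ℕ.+ 4 ℕ.* P ℕ.* a ℕ.+ 0) (sym a≡1+3b)))
        where
        exponent : ∀ P b → P ℕ.+ (1 ℕ.+ 2 ℕ.* b) ℕ.* (6 ℕ.* P) ≡ 3 ℕ.* P ℕ.+ 4 ℕ.* P ℕ.* (1 ℕ.+ b ℕ.* 3) ℕ.+ 0
        exponent = NatSolver.solve-∀
      ω₆⁵≈ : monoₚ (5 ℕ.* P) ≈ monoₚ (3 ℕ.* P ℕ.+ 4 ℕ.* P ℕ.* d) mod XN-1 L
      ω₆⁵≈ = monoₚ-cong (1 ℕ.+ 2 ℕ.* e) 0 (trans (exponent P e) (cong (λ d → 3 ℕ.* P ℕ.+ 4 ℕ.* P ℕ.* d ℕ.+ 0) (sym d≡2+3e)))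
        where
        exponent : ∀ P e → 5 ℕ.* P ℕ.+ (1 ℕ.+ 2 ℕ.* e) ℕ.* (6 ℕ.* P) ≡ 3 ℕ.* P ℕ.+ 4 ℕ.* P ℕ.* (2 ℕ.+ e ℕ.* 3) ℕ.+ 0
        exponent = NatSolver.solve-∀
      ω₆-term : monoₚ (L / 6 ℕ.+ ψ) ≈ negₚ (monoₚ (a ℕ.* s)) mod Φ L
      ω₆-term rewrite L/6≡P = twisted a ω₆≈ Xᵠ≈Xᵃᵗ
      ω₆⁵-term : monoₚ (5 ℕ.* (L / 6) ℕ.+ ψ⁻) ≈ negₚ (monoₚ (d ℕ.* s)) mod Φ L
      ω₆⁵-term rewrite L/6≡P = twisted d ω₆⁵≈ Xᵠ⁻≈Xᵈᵗ

    S? : (a : ℕ) → Dec (1 ℕ.≤ a × gcd a m ≡ 1 × a % 3 ≡ 1)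
    S? a = (1 ℕ.≤? a) ×-dec ((gcd a m ℕ.≟ 1) ×-dec (a % 3 ℕ.≟ 1))

    S′? : (a : ℕ) → Dec (1 ℕ.≤ a × gcd a m ≡ 1 × a % 3 ≡ 2)
    S′? a = (1 ℕ.≤? a) ×-dec ((gcd a m ℕ.≟ 1) ×-dec (a % 3 ℕ.≟ 2))

    1<m : 1 ℕ.< m
    1<m = ℕ.<-≤-trans (s≤s (s≤s z≤n)) (∣⇒≤ {{ℕ.>-nonZero 0<m}} 3∣m)

    Xᵃˢ : ℕ → Poly
    Xᵃˢ a = monoₚ (a ℕ.* s)

    S-mirror⇒S′ : ∀ {b} → b ℕ.< m → 1 ℕ.≤ m ∸ b × gcd (m ∸ b) m ≡ 1 × (m ∸ b) % 3 ≡ 1 →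
                  1 ℕ.≤ b × gcd b m ≡ 1 × b % 3 ≡ 2
    S-mirror⇒S′ {b} b<m (_ , gcd≡1 , r≡1) = gcd≡1⇒0< 1<m gcd-b≡1 , gcd-b≡1 ,
      [3∸r]%3≡1⇒r≡2 (b % 3) (m%n<n b 3) (trans (sym (complement-residue b 3∣m (ℕ.<⇒≤ b<m))) r≡1)
      where gcd-b≡1 = trans (sym (gcd[m∸a,m]≡gcd[a,m] (ℕ.<⇒≤ b<m))) gcd≡1

    S′⇒S-mirror : ∀ {b} → b ℕ.< m → 1 ℕ.≤ b × gcd b m ≡ 1 × b % 3 ≡ 2 →
                  1 ℕ.≤ m ∸ b × gcd (m ∸ b) m ≡ 1 × (m ∸ b) % 3 ≡ 1
    S′⇒S-mirror {b} b<m (_ , gcd≡1 , r≡2) = ℕ.m<n⇒0<n∸m b<m , trans (gcd[m∸a,m]≡gcd[a,m] (ℕ.<⇒≤ b<m)) gcd≡1 ,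
      trans (complement-residue b 3∣m (ℕ.<⇒≤ b<m)) (cong (λ r → (3 ∸ r) % 3) r≡2)

    mirror : Σ< m (λ a → if does (S? a) then Xᵃˢ (m ∸ a) else []) ≋ Σ< m (λ a → if does (S′? a) then Xᵃˢ a else [])
    mirror = begin
      Σ< m (λ a → if does (S? a) then Xᵃˢ (m ∸ a) else [])           ≈⟨ Σ<-cong m (λ a a<m → ≡⇒≋ (cong (λ b → g′ b (m ∸ a))
                                                                                           (ℕ.m∸[m∸n]≡n (ℕ.<⇒≤ a<m)))) ⟨
      Σ< m (λ a → g (m ∸ a))                                         ≈⟨ Σ<-reflect m g (≋-trans (if-no (S? m) (Xᵃˢ 0) S-m)
                                                                                           (≋-sym (if-no (S? (m ∸ m)) (Xᵃˢ m) S-0))) ⟩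
      Σ< m g                                                         ≈⟨ Σ<-cong m (λ b b<m → if-⇔ (S? (m ∸ b)) (S′? b)
                                                                              (S-mirror⇒S′ b<m) (S′⇒S-mirror b<m) ≋-refl) ⟩
      Σ< m (λ a → if does (S′? a) then Xᵃˢ a else [])               ∎
      where
      open ≋-Reasoning
      g′ : ℕ → ℕ → Poly
      g′ b c = if does (S? b) then Xᵃˢ c else []
      g : ℕ → Poly
      g b = g′ (m ∸ b) b
      S-m : ¬ (1 ℕ.≤ m × gcd m m ≡ 1 × m % 3 ≡ 1)
      S-m (_ , gcd≡1 , _) = ℕ.<⇒≱ 1<m (∣⇒≤ (subst (m ∣_) gcd≡1 (gcd-greatest ℕ.∣-refl ℕ.∣-refl)))
      S-0 : ¬ (1 ℕ.≤ m ∸ m × gcd (m ∸ m) m ≡ 1 × (m ∸ m) % 3 ≡ 1)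
      S-0 (1≤0 , _) = ℕ.<⇒≱ 1≤0 (ℕ.≤-reflexive (ℕ.n∸n≡0 m))

    units : Σ< m (λ a → if does (S? a) then Xᵃˢ a else []) +ₚ Σ< m (λ a → if does (S′? a) then Xᵃˢ a else [])
            ≋ ramanujanSum m s
    units = ≋-trans (≋-sym (Σ<-+ m _ _)) (Σ<-cong m λ a _ → split a)
      where
      1≢2 : 1 ≢ 2
      1≢2 ()
      split : ∀ a → (if does (S? a) then Xᵃˢ a else []) +ₚ (if does (S′? a) then Xᵃˢ a else [])
                    ≋ (if does (gcd a m ℕ.≟ 1) then Xᵃˢ a else [])
      split a with gcd a m ℕ.≟ 1
      ... | no  gcd≢1 = ≋-trans (+ₚ-cong (if-no (S? a) (Xᵃˢ a) (gcd≢1 ∘ proj₁ ∘ proj₂))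
                                         (if-no (S′? a) (Xᵃˢ a) (gcd≢1 ∘ proj₁ ∘ proj₂)))
                                (≋-sym (if-no (gcd a m ℕ.≟ 1) (Xᵃˢ a) gcd≢1))
      ... | yes gcd≡1 with coprime-residue a 3∣m gcd≡1
      ...   | inj₁ r≡1 = ≋-trans (+ₚ-cong (if-yes (S? a) (Xᵃˢ a) (gcd≡1⇒0< 1<m gcd≡1 , gcd≡1 , r≡1))
                                          (if-no (S′? a) (Xᵃˢ a) λ (_ , _ , r≡2) → 1≢2 (trans (sym r≡1) r≡2)))
                                 (≋-trans (+ₚ-identityʳ (Xᵃˢ a)) (≋-sym (if-yes (gcd a m ℕ.≟ 1) (Xᵃˢ a) gcd≡1)))
      ...   | inj₂ r≡2 = ≋-trans (+ₚ-cong (if-no (S? a) (Xᵃˢ a) λ (_ , _ , r≡1) → 1≢2 (trans (sym r≡1) r≡2))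
                                          (if-yes (S′? a) (Xᵃˢ a) (gcd≡1⇒0< 1<m gcd≡1 , gcd≡1 , r≡2)))
                                 (≋-sym (if-yes (gcd a m ℕ.≟ 1) (Xᵃˢ a) gcd≡1))

    Zpoly≋ : Zpoly x m α ≋ Σ< m (λ a → if does (S? a) then term α (pow x a) else [])
    Zpoly≋ = foldr-+ₚ-filter-upTo S? (λ a → term α (pow x a)) m

    Σterm≈ : Σ< m (λ a → if does (S? a) then term α (pow x a) else [])
             ≈ Σ< m (λ a → if does (S? a) then negₚ (Xᵃˢ a +ₚ Xᵃˢ (m ∸ a)) else []) mod Φ L
    Σterm≈ = Σ<-cong-mod m λ a a<m → if-cong-mod (S? a) λ (_ , _ , a%3≡1) → term≈ a a<m a%3≡1

    Σpairs≋ : Σ< m (λ a → if does (S? a) then negₚ (Xᵃˢ a +ₚ Xᵃˢ (m ∸ a)) else []) ≋ negₚ (ramanujanSum m s)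
    Σpairs≋ = ≋-trans (Σ<-cong m λ a _ → if-negₚ-+ₚ (does (S? a)) (Xᵃˢ a) (Xᵃˢ (m ∸ a)))
                (≋-trans (Σ<-negₚ m _) (scaleₚ-cong (ℤ.- + 1) (≋-trans (Σ<-+ m _ _) (≋-trans (+ₚ-cong ≋-refl mirror) units))))

    Zpoly-constant : ∃ λ c → Zpoly x m α ≈ constₚ c mod Φ L
    Zpoly-constant = ℤ.- c , ≈mod-trans (≋⇒≈mod Zpoly≋) (≈mod-trans Σterm≈ (≈mod-trans (≋⇒≈mod Σpairs≋)
                       (≈mod-trans (negₚ-cong-mod R≈c) (≋⇒≈mod (≋-sym (constₚ-neg c))))))
      where
      c = proj₁ (ramanujanSum-constant 0<L m s 0<m L∣ms)
      R≈c = proj₂ (ramanujanSum-constant 0<L m s 0<m L∣ms)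

lemma3p4 : (k : ℕ) (n : Fin k → ℕ) (nz : (j : Fin k) → NonZero (n j))
           (x : Grp.Elt k n nz) (m : ℕ) → Grp.IsOrder k n nz x m → 3 ∣ m →
           (α : Grp.Elt k n nz) → Grp.ZIsInteger k n nz x m α
lemma3p4 k n nz x m ord 3∣m α = ≈constₚ⇒IsIntegerAt {L = Grp.L k n nz} (proj₂ (Zpoly-constant k n nz x m ord 3∣m α))
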